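{- For integers $1\le k\le n$, \[E_{k,n}(x)=E_{k-1,n-1}(x)+x\sum_{j=0}^{k-1}\binom{n-1}{j}A_j(x)\,E_{k-1-j,n-1-j}(x),\] and this recurrence together with the initial conditions $E_{0,n}(x)=1$ for all $n\ge0$ determines the polynomials $E_{k,n}(x)$ uniquely.
   Context: $A_0(x)=1$ and $A_n(x)=\sum_{\sigma\in\mathfrak{S}_n}x^{\operatorname{des}(\sigma)}$ for $n\ge1$, $\operatorname{des}(\sigma)=|\{i\in[n-1]:\sigma_i>\sigma_{i+1}\}|$. For $2\le k\le n$, let $\mathbf{s}=(s_1,\ldots,s_{k-1})=(n-k+2,\ldots,n)$, $\mathcal{I}_{k,n}=\{(e_1,\ldots,e_{k-1})\in\mathbb{Z}^{k-1}:0\le e_i<s_i\}$ with conventions $e_0=e_k=0$, $s_0=s_k=1$; an index $i\in[0,k-1]$ is an ascent if $e_i/s_i<e_{i+1}/s_{i+1}$ and a collision if $e_i/s_i=e_{i+1}/s_{i+1}$. Set $E_{k,n}(x)=\sum_{\mathbf{e}\in\mathcal{I}_{k,n}}(1+x)^{\operatorname{col}(\mathbf{e})}x^{\operatorname{asc}(\mathbf{e})}$ for $2\le k\le n$, $E_{1,n}(x)=1+x$ for $n\ge1$, and $E_{0,n}(x)=1$ for $n\ge0$. -}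

module Defs where

open import Data.Nat using (ℕ; zero; suc; _∸_; _<ᵇ_; _≡ᵇ_)
import Data.Nat as ℕ
open import Data.Nat.Combinatorics using (_C_)
open import Data.Integer using (ℤ; +_; _+_; _*_)
open import Data.List using (List; []; _∷_; map; foldr; upTo; concatMap; filterᵇ; _++_)
open import Data.Bool using (Bool; true; false; if_then_else_; _∧_; not)
open import Data.Product using (_×_; _,_)
open import Relation.Binary.PropositionalEquality using (_≡_)

-- Polynomials in x with integer coefficients, as coefficient functions
-- (p i = coefficient of x^i).  Equality is coefficientwise.

Poly : Set
Poly = ℕ → ℤ

_≈ₚ_ : Poly → Poly → Set
p ≈ₚ q = ∀ i → p i ≡ q i

infix 4 _≈ₚ_
infixl 6 _+ₚ_
infixl 7 _*ₚ_
infixr 8 _^ₚ_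

0ₚ : Poly
0ₚ _ = + 0

1ₚ : Poly
1ₚ zero    = + 1
1ₚ (suc _) = + 0

Xₚ : Poly
Xₚ (suc zero) = + 1
Xₚ _          = + 0

_+ₚ_ : Poly → Poly → Poly
(p +ₚ q) i = p i + q i

sumℤ : List ℤ → ℤ
sumℤ = foldr _+_ (+ 0)

_*ₚ_ : Poly → Poly → Poly
(p *ₚ q) i = sumℤ (map (λ j → p j * q (i ∸ j)) (upTo (suc i)))

_^ₚ_ : Poly → ℕ → Poly
p ^ₚ zero  = 1ₚ
p ^ₚ suc m = p *ₚ (p ^ₚ m)

scaleₚ : ℤ → Poly → Poly
scaleₚ c p i = c * p i

sumₚ : List Poly → Poly
sumₚ = foldr _+ₚ_ 0ₚ

-- Eulerian polynomials A_n(x) = Σ_{σ ∈ S_n} x^{des σ}.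
-- A permutation of [n] is represented by its one-line word
-- σ_1 … σ_n (values in {0,…,n-1}, all distinct).

words : ℕ → ℕ → List (List ℕ)
words m zero    = [] ∷ []
words m (suc l) = concatMap (λ a → map (a ∷_) (words m l)) (upTo m)

elemᵇ : ℕ → List ℕ → Bool
elemᵇ a []       = false
elemᵇ a (b ∷ bs) = if a ≡ᵇ b then true else elemᵇ a bs

distinctᵇ : List ℕ → Bool
distinctᵇ []       = true
distinctᵇ (a ∷ as) = not (elemᵇ a as) ∧ distinctᵇ as

perms : ℕ → List (List ℕ)
perms n = filterᵇ distinctᵇ (words n n)

des : List ℕ → ℕ
des (a ∷ b ∷ rest) = (if b <ᵇ a then 1 else 0) ℕ.+ des (b ∷ rest)
des _              = 0

Eulerian : ℕ → Poly
Eulerian n = sumₚ (map (λ σ → Xₚ ^ₚ des σ) (perms n))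

boxes : List ℕ → List (List ℕ)
boxes []       = [] ∷ []
boxes (b ∷ bs) = concatMap (λ a → map (a ∷_) (boxes bs)) (upTo b)

zipL : List ℕ → List ℕ → List (ℕ × ℕ)
zipL (a ∷ as) (b ∷ bs) = (a , b) ∷ zipL as bs
zipL _ _ = []

extended : List ℕ → List ℕ → List (ℕ × ℕ)
extended e s = ((0 , 1) ∷ zipL e s) ++ ((0 , 1) ∷ [])

-- e_i/s_i < e_{i+1}/s_{i+1}  iff  e_i s_{i+1} < e_{i+1} s_i  (all s positive)
ascᵇ : ℕ × ℕ → ℕ × ℕ → Bool
ascᵇ (e , s) (e' , s') = (e ℕ.* s') <ᵇ (e' ℕ.* s)

colᵇ : ℕ × ℕ → ℕ × ℕ → Bool
colᵇ (e , s) (e' , s') = (e ℕ.* s') ≡ᵇ (e' ℕ.* s)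

countAdj : (ℕ × ℕ → ℕ × ℕ → Bool) → List (ℕ × ℕ) → ℕ
countAdj r (p ∷ q ∷ rest) = (if r p q then 1 else 0) ℕ.+ countAdj r (q ∷ rest)
countAdj r _              = 0

sVec : ℕ → ℕ → List ℕ
sVec k n = map (λ j → (n ∸ k) ℕ.+ 2 ℕ.+ j) (upTo (k ∸ 1))

1+x : Poly
1+x = 1ₚ +ₚ Xₚ

Eterm : List ℕ → List ℕ → Poly
Eterm s e = let ps = extended e s in
  (1+x ^ₚ countAdj colᵇ ps) *ₚ (Xₚ ^ₚ countAdj ascᵇ ps)

-- E k n = E_{k,n}(x); only meaningful for k ≤ n.
E : ℕ → ℕ → Poly
E zero          n = 1ₚ
E (suc zero)    n = 1+x
E (suc (suc m)) n = sumₚ (map (Eterm (sVec (suc (suc m)) n)) (boxes (sVec (suc (suc m)) n)))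

-- Right-hand side of the recurrence for F_{k+1,n+1}:
--   F_{k,n} + x Σ_{j=0}^{k} C(n,j) A_j(x) F_{k-j,n-j}

recRHS : (ℕ → ℕ → Poly) → ℕ → ℕ → Poly
recRHS F k n = F k n +ₚ Xₚ *ₚ sumₚ (map (λ j → scaleₚ (+ (n C j)) (Eulerian j *ₚ F (k ∸ j) (n ∸ j))) (upTo (suc k)))

module Submission where

-- Ascents and collisions only compare neighbouring entries, and for consecutive box sizes s, s + 1
-- the test e/s < e′/(s + 1) is just e < e′.  So E_{k+1,n+1} is a transfer-matrix sum over paths
-- 0 = e₀, e₁, …, e_k, e_{k+1} = 0 with e_i < n - k + 1 + i.  Splitting a path at its last interior
-- zero gives E_{k+1,n+1} = (1 + x) E_{k,n} + x Σ_{i<k} E_{i,n-k+i} S_i, where S_i counts by ascents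
-- the sequences (u₀, …, u_{k-1-i}) with u_t < n - k + 1 + i + t.  Raising all these bounds by one
-- multiplies the ascent polynomial by a ratio of binomial coefficients (an intertwining identity
-- for the transfer operator), and for the bounds u_t < 1 + t it counts permutations by descents;
-- hence S_i = C(n, k - i) A_{k-i}.

open import Algebra using (CommutativeRing)
import Algebra.Properties.CommutativeSemigroup as CommSemigroupProperties
open import Data.Bool using (Bool; true; false; if_then_else_; T; _∧_; not)
open import Data.Empty using (⊥; ⊥-elim)
open import Data.Integer as ℤ using (+_)
open import Data.List using (List; []; _∷_; map; upTo; applyUpTo; concat; concatMap; filterᵇ; _++_)
open import Data.List.Properties using (map-applyUpTo)
open import Data.Nat using (ℕ; zero; suc; _∸_; _<_; _≤_; z≤n; s≤s; _<ᵇ_; _≡ᵇ_; _<?_)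
import Data.Nat as ℕ
open import Data.Nat.Combinatorics using (_C_; nCn≡1)
import Data.Nat.Properties as ℕ
open import Data.Product using (_×_; _,_)
open import Function using (_∘_)
open import Relation.Binary using (tri<; tri≈; tri>)
open import Relation.Binary.PropositionalEquality as ≡ using (_≡_; _≢_)
open import Relation.Nullary using (yes; no)

open import Defs

module FiniteSum {c ℓ} (R : CommutativeRing c ℓ) where

  open CommutativeRing R
  open CommSemigroupProperties +-commutativeSemigroup using (interchange)
  open import Relation.Binary.Reasoning.Setoid setoid

  Σ : ℕ → (ℕ → Carrier) → Carrier
  Σ zero    f = 0#
  Σ (suc n) f = Σ n f + f n

  Σ-cong-< : ∀ n {f g} → (∀ i → i < n → f i ≈ g i) → Σ n f ≈ Σ n g
  Σ-cong-< zero    f≈g = refl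
  Σ-cong-< (suc n) f≈g =
    +-cong (Σ-cong-< n (λ i i<n → f≈g i (ℕ.m<n⇒m<1+n i<n))) (f≈g n (ℕ.n<1+n n))

  Σ-cong : ∀ n {f g} → (∀ i → f i ≈ g i) → Σ n f ≈ Σ n g
  Σ-cong n f≈g = Σ-cong-< n (λ i _ → f≈g i)

  Σ-zero : ∀ n → Σ n (λ _ → 0#) ≈ 0#
  Σ-zero zero    = refl
  Σ-zero (suc n) = trans (+-identityʳ _) (Σ-zero n)

  Σ-distrib-+ : ∀ n f g → Σ n (λ i → f i + g i) ≈ Σ n f + Σ n g
  Σ-distrib-+ zero    f g = sym (+-identityʳ 0#)
  Σ-distrib-+ (suc n) f g = trans (+-congʳ (Σ-distrib-+ n f g)) (interchange _ _ _ _)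

  *-distribˡ-Σ : ∀ n a f → a * Σ n f ≈ Σ n (λ i → a * f i)
  *-distribˡ-Σ zero    a f = zeroʳ a
  *-distribˡ-Σ (suc n) a f = trans (distribˡ a _ _) (+-congʳ (*-distribˡ-Σ n a f))

  *-distribʳ-Σ : ∀ n a f → Σ n f * a ≈ Σ n (λ i → f i * a)
  *-distribʳ-Σ n a f =
    trans (*-comm _ a) (trans (*-distribˡ-Σ n a f) (Σ-cong n (λ i → *-comm a (f i))))

  Σ-head : ∀ n f → Σ (suc n) f ≈ f 0 + Σ n (f ∘ suc)
  Σ-head zero    f = trans (+-identityˡ _) (sym (+-identityʳ _))
  Σ-head (suc n) f = trans (+-congʳ (Σ-head n f)) (+-assoc _ _ _)

  Σ-init : ∀ n f → f n ≈ 0# → Σ (suc n) f ≈ Σ n f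
  Σ-init n f fn≈0 = trans (+-congˡ fn≈0) (+-identityʳ _)

  Σ-tail : ∀ n f → f 0 ≈ 0# → Σ (suc n) f ≈ Σ n (f ∘ suc)
  Σ-tail n f f0≈0 = trans (Σ-head n f) (trans (+-congʳ f0≈0) (+-identityˡ _))

  Σ-comm : ∀ m n (f : ℕ → ℕ → Carrier) →
           Σ m (λ i → Σ n (f i)) ≈ Σ n (λ j → Σ m (λ i → f i j))
  Σ-comm zero    n f = sym (Σ-zero n)
  Σ-comm (suc m) n f = trans (+-congʳ (Σ-comm m n f)) (sym (Σ-distrib-+ n _ _))

  Σ-reverse : ∀ n f → Σ n f ≈ Σ n (λ i → f (n ∸ suc i))
  Σ-reverse zero    f = refl
  Σ-reverse (suc n) f = begin
    Σ n f + f n                          ≈⟨ +-congʳ (Σ-reverse n f) ⟩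
    Σ n (λ i → f (n ∸ suc i)) + f n      ≈⟨ +-comm _ _ ⟩
    f n + Σ n (λ i → f (n ∸ suc i))      ≈⟨ Σ-head n (λ i → f (suc n ∸ suc i)) ⟨
    Σ (suc n) (λ i → f (suc n ∸ suc i))  ∎

  Σ-*-Σ : ∀ m n (x : ℕ → Carrier) (y : ℕ → ℕ → Carrier) (z : ℕ → Carrier) →
          Σ n (λ j → Σ m (λ i → x i * y i j) * z j) ≈ Σ m (λ i → x i * Σ n (λ j → y i j * z j))
  Σ-*-Σ m n x y z = begin
    Σ n (λ j → Σ m (λ i → x i * y i j) * z j)   ≈⟨ Σ-cong n (λ j → *-distribʳ-Σ m (z j) _) ⟩
    Σ n (λ j → Σ m (λ i → (x i * y i j) * z j)) ≈⟨ Σ-comm n m _ ⟩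
    Σ m (λ i → Σ n (λ j → (x i * y i j) * z j)) ≈⟨ Σ-cong m (λ i → Σ-cong n (λ j → *-assoc _ _ _)) ⟩
    Σ m (λ i → Σ n (λ j → x i * (y i j * z j))) ≈⟨ Σ-cong m (λ i → *-distribˡ-Σ n (x i) _) ⟨
    Σ m (λ i → x i * Σ n (λ j → y i j * z j))   ∎

  Σ-triangle : ∀ n (F : ℕ → ℕ → Carrier) →
               Σ n (λ j → Σ (suc j) (λ l → F l j)) ≈ Σ n (λ l → Σ (n ∸ l) (λ m → F l (l ℕ.+ m)))
  Σ-triangle zero    F = refl
  Σ-triangle (suc n) F = begin
    Σ n (λ j → Σ (suc j) (λ l → F l j)) + Σ (suc n) (λ l → F l n)
      ≈⟨ +-congʳ (Σ-triangle n F) ⟩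
    Σ n (λ l → Σ (n ∸ l) (λ m → F l (l ℕ.+ m))) + Σ (suc n) (λ l → F l n)
      ≈⟨ +-congʳ (Σ-init n (λ l → Σ (n ∸ l) (λ m → F l (l ℕ.+ m))) emptyLast) ⟨
    Σ (suc n) (λ l → Σ (n ∸ l) (λ m → F l (l ℕ.+ m))) + Σ (suc n) (λ l → F l n)
      ≈⟨ Σ-distrib-+ (suc n) _ _ ⟨
    Σ (suc n) (λ l → Σ (n ∸ l) (λ m → F l (l ℕ.+ m)) + F l n)
      ≈⟨ Σ-cong-< (suc n) (λ l l<1+n → extend l (ℕ.≤-pred l<1+n)) ⟩
    Σ (suc n) (λ l → Σ (suc n ∸ l) (λ m → F l (l ℕ.+ m))) ∎
    where
    emptyLast : Σ (n ∸ n) (λ m → F n (n ℕ.+ m)) ≈ 0#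
    emptyLast = reflexive (≡.cong (λ k → Σ k (λ m → F n (n ℕ.+ m))) (ℕ.n∸n≡0 n))

    extend : ∀ l → l ≤ n → Σ (n ∸ l) (λ m → F l (l ℕ.+ m)) + F l n ≈ Σ (suc n ∸ l) (λ m → F l (l ℕ.+ m))
    extend l l≤n rewrite ℕ.+-∸-assoc 1 l≤n =
      +-congˡ (reflexive (≡.cong (F l) (≡.sym (ℕ.m+[n∸m]≡n l≤n))))

module Binomial where

  open import Data.Nat using (_+_; _*_)
  open import Data.Nat.Combinatorics using (nC1≡n; nCk+nC[k+1]≡[n+1]C[k+1])
  open import Data.Nat.Solver using (module +-*-Solver)
  open +-*-Solver
  open ≡.≡-Reasoning

  pascal : ∀ n k → suc n C suc k ≡ n C k + n C suc k
  pascal n k = ≡.sym (nCk+nC[k+1]≡[n+1]C[k+1] n k)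

  absorption : ∀ n k → suc k * (suc n C suc k) ≡ suc n * (n C k)
  absorption zero    zero    = ≡.refl
  absorption zero    (suc k) = ℕ.*-zeroʳ (suc (suc k))
  absorption (suc n) zero    =
    ≡.trans (ℕ.*-identityˡ _) (≡.trans (nC1≡n (suc (suc n))) (≡.sym (ℕ.*-identityʳ _)))
  absorption (suc n) (suc k) = begin
    suc (suc k) * (suc (suc n) C suc (suc k))
      ≡⟨ ≡.cong (suc (suc k) *_) (pascal (suc n) (suc k)) ⟩
    suc (suc k) * (a + b)
      ≡⟨ solve 3 (λ k a b → (con 2 :+ k) :* (a :+ b) := ((con 1 :+ k) :* a :+ a) :+ (con 2 :+ k) :* b)
               ≡.refl k a b ⟩
    (suc k * a + a) + suc (suc k) * b
      ≡⟨ ≡.cong₂ (λ u v → (u + a) + v) (absorption n k) (absorption n (suc k)) ⟩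
    (suc n * (n C k) + a) + suc n * (n C suc k)
      ≡⟨ solve 4 (λ n a x y → ((con 1 :+ n) :* x :+ a) :+ (con 1 :+ n) :* y
                               := (con 1 :+ n) :* (x :+ y) :+ a) ≡.refl n a (n C k) (n C suc k) ⟩
    suc n * (n C k + n C suc k) + a
      ≡⟨ ≡.cong (λ u → suc n * u + a) (pascal n k) ⟨
    suc n * a + a
      ≡⟨ ℕ.+-comm (suc n * a) a ⟩
    suc (suc n) * a ∎
    where
    a b : ℕ
    a = suc n C suc k
    b = suc n C suc (suc k)

  -- (N + 1) C(N, r) = (N + 1 - r) C(N + 1, r) with N = j + d and r = j + 1, free of subtraction.
  [1+j+d]*[j+d]C[1+j]≡d*[1+j+d]C[1+j] : ∀ d j →
    suc (j + d) * ((j + d) C suc j) ≡ d * (suc (j + d) C suc j)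
  [1+j+d]*[j+d]C[1+j]≡d*[1+j+d]C[1+j] d j = ℕ.+-cancelʳ-≡ (suc j * X) _ _ (begin
    suc N * (N C suc j) + suc j * X         ≡⟨ ≡.cong (_+_ (suc N * (N C suc j))) (absorption N j) ⟩
    suc N * (N C suc j) + suc N * (N C j)   ≡⟨ ℕ.*-distribˡ-+ (suc N) (N C suc j) (N C j) ⟨
    suc N * (N C suc j + N C j)             ≡⟨ ≡.cong (suc N *_) (≡.trans (ℕ.+-comm (N C suc j) _)
                                                                        (≡.sym (pascal N j))) ⟩
    suc N * X                               ≡⟨ ≡.cong (_* X) (≡.trans (≡.cong suc (ℕ.+-comm j d))
                                                                      (≡.sym (ℕ.+-suc d j))) ⟩
    (d + suc j) * X                         ≡⟨ ℕ.*-distribʳ-+ X d (suc j) ⟩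
    d * X + suc j * X                       ∎)
    where
    N X : ℕ
    N = j + d
    X = suc N C suc j

module PolynomialRing where

  open import Algebra.Structures using (IsCommutativeRing)
  open import Data.Integer using (ℤ)
  import Data.Integer.Properties as ℤ
  open import Relation.Binary.Structures using (IsEquivalence)
  open ≡.≡-Reasoning
  open FiniteSum ℤ.+-*-commutativeRing

  sumℤ-applyUpTo : ∀ n (f : ℕ → ℕ) (g : ℕ → ℤ) → sumℤ (map g (applyUpTo f n)) ≡ Σ n (g ∘ f)
  sumℤ-applyUpTo zero    f g = ≡.refl
  sumℤ-applyUpTo (suc n) f g =
    ≡.trans (≡.cong (ℤ._+_ (g (f 0))) (sumℤ-applyUpTo n (f ∘ suc) g)) (≡.sym (Σ-head n (g ∘ f)))

  *ₚ-coeff : ∀ p q i → (p *ₚ q) i ≡ Σ (suc i) (λ j → p j ℤ.* q (i ∸ j))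
  *ₚ-coeff p q i = sumℤ-applyUpTo (suc i) (λ j → j) _

  *ₚ-cong : ∀ {p p′ q q′} → p ≈ₚ p′ → q ≈ₚ q′ → p *ₚ q ≈ₚ p′ *ₚ q′
  *ₚ-cong {p} {p′} {q} {q′} p≈p′ q≈q′ i = begin
    (p *ₚ q) i                             ≡⟨ *ₚ-coeff p q i ⟩
    Σ (suc i) (λ j → p j ℤ.* q (i ∸ j))    ≡⟨ Σ-cong (suc i) (λ j → ≡.cong₂ ℤ._*_ (p≈p′ j) (q≈q′ (i ∸ j))) ⟩
    Σ (suc i) (λ j → p′ j ℤ.* q′ (i ∸ j))  ≡⟨ *ₚ-coeff p′ q′ i ⟨
    (p′ *ₚ q′) i                           ∎

  *ₚ-comm : ∀ p q → p *ₚ q ≈ₚ q *ₚ p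
  *ₚ-comm p q i = begin
    (p *ₚ q) i                                     ≡⟨ *ₚ-coeff p q i ⟩
    Σ (suc i) (λ j → p j ℤ.* q (i ∸ j))            ≡⟨ Σ-reverse (suc i) _ ⟩
    Σ (suc i) (λ j → p (i ∸ j) ℤ.* q (i ∸ (i ∸ j))) ≡⟨ Σ-cong-< (suc i) swap ⟩
    Σ (suc i) (λ j → q j ℤ.* p (i ∸ j))            ≡⟨ *ₚ-coeff q p i ⟨
    (q *ₚ p) i                                     ∎
    where
    swap : ∀ j → j < suc i → p (i ∸ j) ℤ.* q (i ∸ (i ∸ j)) ≡ q j ℤ.* p (i ∸ j)
    swap j j<1+i = ≡.trans (≡.cong (λ k → p (i ∸ j) ℤ.* q k) (ℕ.m∸[m∸n]≡n (ℕ.≤-pred j<1+i)))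
                           (ℤ.*-comm (p (i ∸ j)) (q j))

  *ₚ-distribˡ-+ₚ : ∀ p q r → p *ₚ (q +ₚ r) ≈ₚ p *ₚ q +ₚ p *ₚ r
  *ₚ-distribˡ-+ₚ p q r i = begin
    (p *ₚ (q +ₚ r)) i
      ≡⟨ *ₚ-coeff p (q +ₚ r) i ⟩
    Σ (suc i) (λ j → p j ℤ.* (q (i ∸ j) ℤ.+ r (i ∸ j)))
      ≡⟨ Σ-cong (suc i) (λ j → ℤ.*-distribˡ-+ (p j) (q (i ∸ j)) (r (i ∸ j))) ⟩
    Σ (suc i) (λ j → p j ℤ.* q (i ∸ j) ℤ.+ p j ℤ.* r (i ∸ j))
      ≡⟨ Σ-distrib-+ (suc i) _ _ ⟩
    Σ (suc i) (λ j → p j ℤ.* q (i ∸ j)) ℤ.+ Σ (suc i) (λ j → p j ℤ.* r (i ∸ j))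
      ≡⟨ ≡.cong₂ ℤ._+_ (*ₚ-coeff p q i) (*ₚ-coeff p r i) ⟨
    (p *ₚ q +ₚ p *ₚ r) i ∎

  fromℕₚ : ℕ → Poly
  fromℕₚ m zero    = + m
  fromℕₚ m (suc _) = + 0

  fromℕₚ-*ₚ : ∀ m p → fromℕₚ m *ₚ p ≈ₚ scaleₚ (+ m) p
  fromℕₚ-*ₚ m p i = begin
    (fromℕₚ m *ₚ p) i                                   ≡⟨ *ₚ-coeff (fromℕₚ m) p i ⟩
    Σ (suc i) (λ j → fromℕₚ m j ℤ.* p (i ∸ j))          ≡⟨ Σ-head i _ ⟩
    + m ℤ.* p i ℤ.+ Σ i (λ j → + 0 ℤ.* p (i ∸ suc j))   ≡⟨ ≡.cong (ℤ._+_ (+ m ℤ.* p i)) vanish ⟩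
    + m ℤ.* p i ℤ.+ + 0                                 ≡⟨ ℤ.+-identityʳ _ ⟩
    + m ℤ.* p i                                         ∎
    where
    vanish : Σ i (λ j → + 0 ℤ.* p (i ∸ suc j)) ≡ + 0
    vanish = ≡.trans (Σ-cong i (λ j → ℤ.*-zeroˡ (p (i ∸ suc j)))) (Σ-zero i)

  fromℕₚ-1-coeff : fromℕₚ 1 ≈ₚ 1ₚ
  fromℕₚ-1-coeff zero    = ≡.refl
  fromℕₚ-1-coeff (suc _) = ≡.refl

  *ₚ-identityˡ : ∀ p → 1ₚ *ₚ p ≈ₚ p
  *ₚ-identityˡ p i = begin
    (1ₚ *ₚ p) i        ≡⟨ *ₚ-cong {q = p} (λ j → ≡.sym (fromℕₚ-1-coeff j)) (λ _ → ≡.refl) i ⟩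
    (fromℕₚ 1 *ₚ p) i  ≡⟨ fromℕₚ-*ₚ 1 p i ⟩
    + 1 ℤ.* p i        ≡⟨ ℤ.*-identityˡ (p i) ⟩
    p i                ∎

  *ₚ-assoc : ∀ p q r → (p *ₚ q) *ₚ r ≈ₚ p *ₚ (q *ₚ r)
  *ₚ-assoc p q r i = begin
    ((p *ₚ q) *ₚ r) i
      ≡⟨ *ₚ-coeff (p *ₚ q) r i ⟩
    Σ (suc i) (λ j → (p *ₚ q) j ℤ.* r (i ∸ j))
      ≡⟨ Σ-cong (suc i) (λ j → ≡.trans (≡.cong (ℤ._* r (i ∸ j)) (*ₚ-coeff p q j)) (*-distribʳ-Σ (suc j) _ _)) ⟩
    Σ (suc i) (λ j → Σ (suc j) (λ l → p l ℤ.* q (j ∸ l) ℤ.* r (i ∸ j)))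
      ≡⟨ Σ-triangle (suc i) (λ l j → p l ℤ.* q (j ∸ l) ℤ.* r (i ∸ j)) ⟩
    Σ (suc i) (λ l → Σ (suc i ∸ l) (λ m → p l ℤ.* q (l ℕ.+ m ∸ l) ℤ.* r (i ∸ (l ℕ.+ m))))
      ≡⟨ Σ-cong-< (suc i) (λ l l<1+i → inner l (ℕ.≤-pred l<1+i)) ⟩
    Σ (suc i) (λ l → p l ℤ.* (q *ₚ r) (i ∸ l))
      ≡⟨ *ₚ-coeff p (q *ₚ r) i ⟨
    (p *ₚ (q *ₚ r)) i ∎
    where
    inner : ∀ l → l ≤ i →
      Σ (suc i ∸ l) (λ m → p l ℤ.* q (l ℕ.+ m ∸ l) ℤ.* r (i ∸ (l ℕ.+ m))) ≡ p l ℤ.* (q *ₚ r) (i ∸ l)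
    inner l l≤i rewrite ℕ.+-∸-assoc 1 l≤i = begin
      Σ (suc (i ∸ l)) (λ m → p l ℤ.* q (l ℕ.+ m ∸ l) ℤ.* r (i ∸ (l ℕ.+ m)))
        ≡⟨ Σ-cong (suc (i ∸ l)) (λ m → ≡.trans (ℤ.*-assoc (p l) _ _)
             (≡.cong₂ (λ a b → p l ℤ.* (q a ℤ.* r b)) (ℕ.m+n∸m≡n l m) (≡.sym (ℕ.∸-+-assoc i l m)))) ⟩
      Σ (suc (i ∸ l)) (λ m → p l ℤ.* (q m ℤ.* r (i ∸ l ∸ m)))
        ≡⟨ *-distribˡ-Σ (suc (i ∸ l)) (p l) _ ⟨
      p l ℤ.* Σ (suc (i ∸ l)) (λ m → q m ℤ.* r (i ∸ l ∸ m))
        ≡⟨ ≡.cong (p l ℤ.*_) (*ₚ-coeff q r (i ∸ l)) ⟨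
      p l ℤ.* (q *ₚ r) (i ∸ l) ∎

  -- A record wrapper around _≈ₚ_, so that both sides can be inferred from an equation.
  record _≋_ (p q : Poly) : Set where
    constructor mk≋
    field pointwise : p ≈ₚ q
  open _≋_ public
  infix 4 _≋_

  -ₚ_ : Poly → Poly
  (-ₚ p) i = ℤ.- p i

  ≋-isEquivalence : IsEquivalence _≋_
  ≋-isEquivalence = record
    { refl  = mk≋ (λ i → ≡.refl)
    ; sym   = λ p≋q → mk≋ (λ i → ≡.sym (pointwise p≋q i))
    ; trans = λ p≋q q≋r → mk≋ (λ i → ≡.trans (pointwise p≋q i) (pointwise q≋r i))
    }

  Poly-isCommutativeRing : IsCommutativeRing _≋_ _+ₚ_ _*ₚ_ -ₚ_ 0ₚ 1ₚ
  Poly-isCommutativeRing = record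
    { isRing = record
      { +-isAbelianGroup = record
        { isGroup = record
          { isMonoid = record
            { isSemigroup = record
              { isMagma = record
                { isEquivalence = ≋-isEquivalence
                ; ∙-cong = λ p≋p′ q≋q′ → mk≋ (λ i → ≡.cong₂ ℤ._+_ (pointwise p≋p′ i) (pointwise q≋q′ i))
                }
              ; assoc = λ p q r → mk≋ (λ i → ℤ.+-assoc (p i) (q i) (r i))
              }
            ; identity = (λ p → mk≋ (λ i → ℤ.+-identityˡ (p i))) , (λ p → mk≋ (λ i → ℤ.+-identityʳ (p i)))
            }
          ; inverse = (λ p → mk≋ (λ i → ℤ.+-inverseˡ (p i))) , (λ p → mk≋ (λ i → ℤ.+-inverseʳ (p i)))
          ; ⁻¹-cong = λ p≋q → mk≋ (λ i → ≡.cong ℤ.-_ (pointwise p≋q i))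
          }
        ; comm = λ p q → mk≋ (λ i → ℤ.+-comm (p i) (q i))
        }
      ; *-cong = λ p≋p′ q≋q′ → mk≋ (*ₚ-cong (pointwise p≋p′) (pointwise q≋q′))
      ; *-assoc = λ p q r → mk≋ (*ₚ-assoc p q r)
      ; *-identity = (λ p → mk≋ (*ₚ-identityˡ p))
                   , (λ p → mk≋ (λ i → ≡.trans (*ₚ-comm p 1ₚ i) (*ₚ-identityˡ p i)))
      ; distrib = (λ p q r → mk≋ (*ₚ-distribˡ-+ₚ p q r))
                , (λ r p q → mk≋ (λ i → ≡.trans (*ₚ-comm (p +ₚ q) r i) (≡.trans (*ₚ-distribˡ-+ₚ r p q i)
                                          (≡.cong₂ ℤ._+_ (*ₚ-comm r p i) (*ₚ-comm r q i)))))
      }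
    ; *-comm = λ p q → mk≋ (*ₚ-comm p q)
    }

  Poly-commutativeRing : CommutativeRing _ _
  Poly-commutativeRing = record { isCommutativeRing = Poly-isCommutativeRing }

  fromℕₚ-0 : fromℕₚ 0 ≋ 0ₚ
  fromℕₚ-0 = mk≋ λ { zero → ≡.refl ; (suc i) → ≡.refl }

  fromℕₚ-1 : fromℕₚ 1 ≋ 1ₚ
  fromℕₚ-1 = mk≋ fromℕₚ-1-coeff

  fromℕₚ-+ : ∀ m n → fromℕₚ (m ℕ.+ n) ≋ fromℕₚ m +ₚ fromℕₚ n
  fromℕₚ-+ m n = mk≋ λ { zero → ℤ.pos-+ m n ; (suc i) → ≡.refl }

  fromℕₚ-*-assoc : ∀ m n p → fromℕₚ (m ℕ.* n) *ₚ p ≋ fromℕₚ m *ₚ (fromℕₚ n *ₚ p)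
  fromℕₚ-*-assoc m n p = mk≋ λ i → begin
    (fromℕₚ (m ℕ.* n) *ₚ p) i     ≡⟨ fromℕₚ-*ₚ (m ℕ.* n) p i ⟩
    + (m ℕ.* n) ℤ.* p i           ≡⟨ ≡.cong (ℤ._* p i) (ℤ.pos-* m n) ⟩
    + m ℤ.* + n ℤ.* p i           ≡⟨ ℤ.*-assoc (+ m) (+ n) (p i) ⟩
    + m ℤ.* (+ n ℤ.* p i)         ≡⟨ ≡.cong (+ m ℤ.*_) (fromℕₚ-*ₚ n p i) ⟨
    + m ℤ.* (fromℕₚ n *ₚ p) i     ≡⟨ fromℕₚ-*ₚ m (fromℕₚ n *ₚ p) i ⟨
    (fromℕₚ m *ₚ (fromℕₚ n *ₚ p)) i ∎

  fromℕₚ-*ₚ-cancel : ∀ m p q → fromℕₚ (suc m) *ₚ p ≋ fromℕₚ (suc m) *ₚ q → p ≋ q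
  fromℕₚ-*ₚ-cancel m p q eq = mk≋ λ i → ℤ.*-cancelˡ-≡ (+ suc m) (p i) (q i) (begin
    + suc m ℤ.* p i             ≡⟨ fromℕₚ-*ₚ (suc m) p i ⟨
    (fromℕₚ (suc m) *ₚ p) i     ≡⟨ pointwise eq i ⟩
    (fromℕₚ (suc m) *ₚ q) i     ≡⟨ fromℕₚ-*ₚ (suc m) q i ⟩
    + suc m ℤ.* q i             ∎)

open PolynomialRing
  using (_≋_; mk≋; pointwise; Poly-commutativeRing;
         fromℕₚ; fromℕₚ-*ₚ; fromℕₚ-0; fromℕₚ-1; fromℕₚ-+; fromℕₚ-*-assoc; fromℕₚ-*ₚ-cancel)
open CommutativeRing Poly-commutativeRing
  using (setoid; +-assoc; +-comm; +-cong; +-congˡ; +-congʳ; +-identityˡ; +-identityʳ;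
         *-assoc; *-comm; *-cong; *-congˡ; *-congʳ; *-identityˡ; *-identityʳ;
         distribˡ; distribʳ; zeroˡ; zeroʳ)
  renaming (refl to ≋-refl; sym to ≋-sym; trans to ≋-trans; reflexive to ≋-reflexive)
open FiniteSum Poly-commutativeRing
open CommSemigroupProperties (CommutativeRing.*-commutativeSemigroup Poly-commutativeRing) using (x∙yz≈y∙xz)
open import Relation.Binary.Reasoning.Setoid setoid

open Binomial using ([1+j+d]*[j+d]C[1+j]≡d*[1+j+d]C[1+j])

-- ℕ's _+_ and _*_ are opened only now: the generic modules above use a ring's.
open import Data.Nat using (_+_; _*_)

T-injective : ∀ {b c} → (T b → T c) → (T c → T b) → b ≡ c
T-injective {false} {false} _ _ = ≡.refl
T-injective {false} {true}  _ g = ⊥-elim (g _)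
T-injective {true}  {false} f _ = ⊥-elim (f _)
T-injective {true}  {true}  _ _ = ≡.refl

<ᵇ-true : ∀ {m n} → m < n → (m <ᵇ n) ≡ true
<ᵇ-true m<n = T-injective (λ _ → _) (λ _ → ℕ.<⇒<ᵇ m<n)

<ᵇ-false : ∀ {m n} → n ≤ m → (m <ᵇ n) ≡ false
<ᵇ-false {m} {n} n≤m = T-injective (λ t → ⊥-elim (ℕ.<⇒≱ (ℕ.<ᵇ⇒< m n t) n≤m)) (λ ())

fromℕₚ-split : ∀ m n k → m + n ≡ k → fromℕₚ m +ₚ fromℕₚ n ≋ fromℕₚ k
fromℕₚ-split m n k m+n≡k = ≋-trans (≋-sym (fromℕₚ-+ m n)) (≋-reflexive (≡.cong fromℕₚ m+n≡k))

sumMap : ∀ {A : Set} → (A → Poly) → List A → Poly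
sumMap f xs = sumₚ (map f xs)

sumMap-cong : ∀ {A : Set} {f g : A → Poly} xs → (∀ x → f x ≋ g x) → sumMap f xs ≋ sumMap g xs
sumMap-cong []       f≋g = ≋-refl
sumMap-cong (x ∷ xs) f≋g = +-cong (f≋g x) (sumMap-cong xs f≋g)

sumMap-zero : ∀ {A : Set} (xs : List A) → sumMap (λ _ → 0ₚ) xs ≋ 0ₚ
sumMap-zero []       = ≋-refl
sumMap-zero (x ∷ xs) = ≋-trans (+-identityˡ _) (sumMap-zero xs)

sumMap-++ : ∀ {A : Set} (f : A → Poly) xs ys → sumMap f (xs ++ ys) ≋ sumMap f xs +ₚ sumMap f ys
sumMap-++ f []       ys = ≋-sym (+-identityˡ _)
sumMap-++ f (x ∷ xs) ys = ≋-trans (+-congˡ {f x} (sumMap-++ f xs ys)) (≋-sym (+-assoc (f x) _ _))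

sumMap-map : ∀ {A B : Set} (f : B → Poly) (g : A → B) xs → sumMap f (map g xs) ≡ sumMap (f ∘ g) xs
sumMap-map f g []       = ≡.refl
sumMap-map f g (x ∷ xs) = ≡.cong (f (g x) +ₚ_) (sumMap-map f g xs)

sumMap-concatMap : ∀ {A B : Set} (f : B → Poly) (g : A → List B) xs →
                   sumMap f (concatMap g xs) ≋ sumMap (λ x → sumMap f (g x)) xs
sumMap-concatMap f g []       = ≋-refl
sumMap-concatMap f g (x ∷ xs) =
  ≋-trans (sumMap-++ f (g x) (concat (map g xs))) (+-congˡ {sumMap f (g x)} (sumMap-concatMap f g xs))

sumMap-applyUpTo : ∀ (f : ℕ → Poly) (g : ℕ → ℕ) n → sumMap f (applyUpTo g n) ≋ Σ n (f ∘ g)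
sumMap-applyUpTo f g zero    = ≋-refl
sumMap-applyUpTo f g (suc n) =
  ≋-trans (+-congˡ {f (g 0)} (sumMap-applyUpTo f (g ∘ suc) n)) (≋-sym (Σ-head n (f ∘ g)))

sumMap-upTo : ∀ (f : ℕ → Poly) n → sumMap f (upTo n) ≋ Σ n f
sumMap-upTo f = sumMap-applyUpTo f (λ i → i)

*-distribˡ-sumMap : ∀ {A : Set} c (f : A → Poly) xs → c *ₚ sumMap f xs ≋ sumMap (λ x → c *ₚ f x) xs
*-distribˡ-sumMap c f []       = zeroʳ c
*-distribˡ-sumMap c f (x ∷ xs) = ≋-trans (distribˡ c (f x) _) (+-congˡ {c *ₚ f x} (*-distribˡ-sumMap c f xs))

whenₚ : Bool → Poly → Poly
whenₚ b p = if b then p else 0ₚ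

sumMap-filterᵇ : ∀ {A : Set} (f : A → Poly) (P : A → Bool) xs →
                 sumMap f (filterᵇ P xs) ≋ sumMap (λ x → whenₚ (P x) (f x)) xs
sumMap-filterᵇ f P []       = ≋-refl
sumMap-filterᵇ f P (x ∷ xs) with P x
... | true  = +-congˡ {f x} (sumMap-filterᵇ f P xs)
... | false = ≋-trans (sumMap-filterᵇ f P xs) (≋-sym (+-identityˡ _))

whenₚ-cong : ∀ b {p q} → p ≋ q → whenₚ b p ≋ whenₚ b q
whenₚ-cong true  p≋q = p≋q
whenₚ-cong false p≋q = ≋-refl

whenₚ-*ₚ : ∀ b c p → whenₚ b (c *ₚ p) ≋ c *ₚ whenₚ b p
whenₚ-*ₚ true  c p = ≋-refl
whenₚ-*ₚ false c p = ≋-sym (zeroʳ c)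

ascWeight : ℕ → ℕ → Poly
ascWeight u v = if u <ᵇ v then Xₚ else 1ₚ

ascWeight-< : ∀ {u v} → u < v → ascWeight u v ≡ Xₚ
ascWeight-< u<v = ≡.cong (λ b → if b then Xₚ else 1ₚ) (<ᵇ-true u<v)

ascWeight-≥ : ∀ {u v} → v ≤ u → ascWeight u v ≡ 1ₚ
ascWeight-≥ v≤u = ≡.cong (λ b → if b then Xₚ else 1ₚ) (<ᵇ-false v≤u)

transfer : ℕ → (ℕ → Poly) → ℕ → Poly
transfer L z v = Σ L (λ u → ascWeight u v *ₚ z u)

transfer-cong : ∀ L {z z′} → (∀ u → u < L → z u ≋ z′ u) → ∀ v → transfer L z v ≋ transfer L z′ v
transfer-cong L z≋z′ v = Σ-cong-< L (λ u u<L → *-congˡ {ascWeight u v} (z≋z′ u u<L))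

transfer-*ₚ : ∀ L c z v → transfer L (λ u → c *ₚ z u) v ≋ c *ₚ transfer L z v
transfer-*ₚ L c z v =
  ≋-trans (Σ-cong L (λ u → x∙yz≈y∙xz (ascWeight u v) c (z u))) (≋-sym (*-distribˡ-Σ L c _))

-- The sequences (u₀, …, u_{j-1}, v) with u_t < d + t, counted by ascents.
shiftedEulerianAt : ℕ → ℕ → ℕ → Poly
shiftedEulerianAt d zero    v = 1ₚ
shiftedEulerianAt d (suc j) v = transfer (j + d) (shiftedEulerianAt d j) v

shiftedEulerian : ℕ → ℕ → Poly
shiftedEulerian d j = Σ (j + d) (shiftedEulerianAt d j)

-- The source of the binomial factor: spread commutes with transfer, raises the bound d by one on
-- shiftedEulerianAt, and multiplies sums by L + 1.
spread : ℕ → (ℕ → Poly) → ℕ → Poly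
spread L z v = fromℕₚ (L ∸ v) *ₚ z v +ₚ fromℕₚ v *ₚ z (v ∸ 1)

[m∸n]+[1+n]≡1+m : ∀ {m n} → n < m → (m ∸ n) + suc n ≡ suc m
[m∸n]+[1+n]≡1+m {m} {n} n<m = ≡.trans (ℕ.+-suc (m ∸ n) n) (≡.cong suc (ℕ.m∸n+n≡m (ℕ.<⇒≤ n<m)))

1+m<n⇒m<n∸1 : ∀ {m n} → suc m < n → m < n ∸ 1
1+m<n⇒m<n∸1 {n = suc n} = ℕ.≤-pred

fromℕₚ-rebalance : ∀ a m n m′ n′ → m + n ≡ m′ + n′ →
              a *ₚ fromℕₚ m +ₚ a *ₚ fromℕₚ n ≋ fromℕₚ m′ *ₚ a +ₚ fromℕₚ n′ *ₚ a
fromℕₚ-rebalance a m n m′ n′ eq = begin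
  a *ₚ fromℕₚ m +ₚ a *ₚ fromℕₚ n  ≈⟨ distribˡ a (fromℕₚ m) (fromℕₚ n) ⟨
  a *ₚ (fromℕₚ m +ₚ fromℕₚ n)     ≈⟨ *-congˡ {a} (fromℕₚ-split m n (m′ + n′) eq) ⟩
  a *ₚ fromℕₚ (m′ + n′)            ≈⟨ *-comm a _ ⟩
  fromℕₚ (m′ + n′) *ₚ a            ≈⟨ *-congʳ (fromℕₚ-+ m′ n′) ⟩
  (fromℕₚ m′ +ₚ fromℕₚ n′) *ₚ a    ≈⟨ distribʳ a (fromℕₚ m′) (fromℕₚ n′) ⟩
  fromℕₚ m′ *ₚ a +ₚ fromℕₚ n′ *ₚ a ∎

ascWeight-spread : ∀ L u v → u < L → v ≤ suc L →
  ascWeight u v *ₚ fromℕₚ (L ∸ u) +ₚ ascWeight (suc u) v *ₚ fromℕₚ (suc u)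
    ≋ fromℕₚ (suc L ∸ v) *ₚ ascWeight u v +ₚ fromℕₚ v *ₚ ascWeight u (v ∸ 1)
ascWeight-spread L u v u<L v≤1+L with ℕ.<-cmp (suc u) v
... | tri< 1+u<v _ _ = begin
  ascWeight u v *ₚ fromℕₚ (L ∸ u) +ₚ ascWeight (suc u) v *ₚ fromℕₚ (suc u)
    ≡⟨ ≡.cong₂ (λ a b → a *ₚ fromℕₚ (L ∸ u) +ₚ b *ₚ fromℕₚ (suc u)) u<v⇒X (ascWeight-< 1+u<v) ⟩
  Xₚ *ₚ fromℕₚ (L ∸ u) +ₚ Xₚ *ₚ fromℕₚ (suc u)
    ≈⟨ fromℕₚ-rebalance Xₚ (L ∸ u) (suc u) (suc L ∸ v) v total ⟩
  fromℕₚ (suc L ∸ v) *ₚ Xₚ +ₚ fromℕₚ v *ₚ Xₚ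
    ≡⟨ ≡.cong₂ (λ a b → fromℕₚ (suc L ∸ v) *ₚ a +ₚ fromℕₚ v *ₚ b) u<v⇒X (ascWeight-< (1+m<n⇒m<n∸1 1+u<v)) ⟨
  fromℕₚ (suc L ∸ v) *ₚ ascWeight u v +ₚ fromℕₚ v *ₚ ascWeight u (v ∸ 1) ∎
  where
  u<v⇒X : ascWeight u v ≡ Xₚ
  u<v⇒X = ascWeight-< (ℕ.<-trans (ℕ.n<1+n u) 1+u<v)
  total : (L ∸ u) + suc u ≡ (suc L ∸ v) + v
  total = ≡.trans ([m∸n]+[1+n]≡1+m u<L) (≡.sym (ℕ.m∸n+n≡m v≤1+L))
... | tri≈ _ ≡.refl _ = begin
  ascWeight u (suc u) *ₚ fromℕₚ (L ∸ u) +ₚ ascWeight (suc u) (suc u) *ₚ fromℕₚ (suc u)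
    ≡⟨ ≡.cong₂ (λ a b → a *ₚ fromℕₚ (L ∸ u) +ₚ b *ₚ fromℕₚ (suc u))
               (ascWeight-< (ℕ.n<1+n u)) (ascWeight-≥ {suc u} ℕ.≤-refl) ⟩
  Xₚ *ₚ fromℕₚ (L ∸ u) +ₚ 1ₚ *ₚ fromℕₚ (suc u)
    ≈⟨ +-cong (*-comm Xₚ (fromℕₚ (L ∸ u))) (*-comm 1ₚ (fromℕₚ (suc u))) ⟩
  fromℕₚ (L ∸ u) *ₚ Xₚ +ₚ fromℕₚ (suc u) *ₚ 1ₚ
    ≡⟨ ≡.cong₂ (λ a b → fromℕₚ (L ∸ u) *ₚ a +ₚ fromℕₚ (suc u) *ₚ b)
               (ascWeight-< (ℕ.n<1+n u)) (ascWeight-≥ {u} ℕ.≤-refl) ⟨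
  fromℕₚ (suc L ∸ suc u) *ₚ ascWeight u (suc u) +ₚ fromℕₚ (suc u) *ₚ ascWeight u (suc u ∸ 1) ∎
... | tri> _ _ v<1+u = begin
  ascWeight u v *ₚ fromℕₚ (L ∸ u) +ₚ ascWeight (suc u) v *ₚ fromℕₚ (suc u)
    ≡⟨ ≡.cong₂ (λ a b → a *ₚ fromℕₚ (L ∸ u) +ₚ b *ₚ fromℕₚ (suc u)) v≤u⇒1 (ascWeight-≥ (ℕ.m≤n⇒m≤1+n v≤u)) ⟩
  1ₚ *ₚ fromℕₚ (L ∸ u) +ₚ 1ₚ *ₚ fromℕₚ (suc u)
    ≈⟨ fromℕₚ-rebalance 1ₚ (L ∸ u) (suc u) (suc L ∸ v) v total ⟩
  fromℕₚ (suc L ∸ v) *ₚ 1ₚ +ₚ fromℕₚ v *ₚ 1ₚ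
    ≡⟨ ≡.cong₂ (λ a b → fromℕₚ (suc L ∸ v) *ₚ a +ₚ fromℕₚ v *ₚ b)
               v≤u⇒1 (ascWeight-≥ (ℕ.≤-trans (ℕ.m∸n≤m v 1) v≤u)) ⟨
  fromℕₚ (suc L ∸ v) *ₚ ascWeight u v +ₚ fromℕₚ v *ₚ ascWeight u (v ∸ 1) ∎
  where
  v≤u : v ≤ u
  v≤u = ℕ.≤-pred v<1+u
  v≤u⇒1 : ascWeight u v ≡ 1ₚ
  v≤u⇒1 = ascWeight-≥ v≤u
  total : (L ∸ u) + suc u ≡ (suc L ∸ v) + v
  total = ≡.trans ([m∸n]+[1+n]≡1+m u<L) (≡.sym (ℕ.m∸n+n≡m v≤1+L))

factorʳ : ∀ x y x′ y′ z → x *ₚ (y *ₚ z) +ₚ x′ *ₚ (y′ *ₚ z) ≋ (x *ₚ y +ₚ x′ *ₚ y′) *ₚ z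
factorʳ x y x′ y′ z = ≋-sym (≋-trans (distribʳ z (x *ₚ y) (x′ *ₚ y′)) (+-cong (*-assoc x y z) (*-assoc x′ y′ z)))

fromℕₚ-0-*ₚ : ∀ p → fromℕₚ 0 *ₚ p ≋ 0ₚ
fromℕₚ-0-*ₚ p = ≋-trans (*-congʳ {p} fromℕₚ-0) (zeroˡ p)

*ₚ-fromℕₚ-0-*ₚ : ∀ a p → a *ₚ (fromℕₚ 0 *ₚ p) ≋ 0ₚ
*ₚ-fromℕₚ-0-*ₚ a p = ≋-trans (*-congˡ {a} (fromℕₚ-0-*ₚ p)) (zeroʳ a)

transfer-spread : ∀ L z v → v ≤ suc L →
                  transfer (suc L) (spread L z) v ≋ spread (suc L) (transfer L z) v
transfer-spread L z v v≤1+L = begin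
  transfer (suc L) (spread L z) v
    ≈⟨ Σ-cong (suc L) (λ u → distribˡ (ascWeight u v) _ _) ⟩
  Σ (suc L) (λ u → left u +ₚ right u)
    ≈⟨ Σ-distrib-+ (suc L) left right ⟩
  Σ (suc L) left +ₚ Σ (suc L) right
    ≈⟨ +-cong (Σ-init L left lastLeft) (Σ-tail L right firstRight) ⟩
  Σ L left +ₚ Σ L (right ∘ suc)
    ≈⟨ Σ-distrib-+ L left (right ∘ suc) ⟨
  Σ L (λ u → left u +ₚ right (suc u))
    ≈⟨ Σ-cong-< L regroup ⟩
  Σ L (λ u → fromℕₚ (suc L ∸ v) *ₚ (ascWeight u v *ₚ z u) +ₚ fromℕₚ v *ₚ (ascWeight u (v ∸ 1) *ₚ z u))
    ≈⟨ Σ-distrib-+ L _ _ ⟩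
  Σ L (λ u → fromℕₚ (suc L ∸ v) *ₚ (ascWeight u v *ₚ z u)) +ₚ Σ L (λ u → fromℕₚ v *ₚ (ascWeight u (v ∸ 1) *ₚ z u))
    ≈⟨ +-cong (*-distribˡ-Σ L (fromℕₚ (suc L ∸ v)) _) (*-distribˡ-Σ L (fromℕₚ v) _) ⟨
  spread (suc L) (transfer L z) v ∎
  where
  left right : ℕ → Poly
  left  u = ascWeight u v *ₚ (fromℕₚ (L ∸ u) *ₚ z u)
  right u = ascWeight u v *ₚ (fromℕₚ u *ₚ z (u ∸ 1))

  lastLeft : left L ≋ 0ₚ
  lastLeft = ≋-trans (≋-reflexive (≡.cong (λ k → ascWeight L v *ₚ (fromℕₚ k *ₚ z L)) (ℕ.n∸n≡0 L)))
                     (*ₚ-fromℕₚ-0-*ₚ (ascWeight L v) (z L))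

  firstRight : right 0 ≋ 0ₚ
  firstRight = *ₚ-fromℕₚ-0-*ₚ (ascWeight 0 v) (z 0)

  regroup : ∀ u → u < L → left u +ₚ right (suc u) ≋
            fromℕₚ (suc L ∸ v) *ₚ (ascWeight u v *ₚ z u) +ₚ fromℕₚ v *ₚ (ascWeight u (v ∸ 1) *ₚ z u)
  regroup u u<L = begin
    left u +ₚ right (suc u)
      ≈⟨ factorʳ (ascWeight u v) (fromℕₚ (L ∸ u)) (ascWeight (suc u) v) (fromℕₚ (suc u)) (z u) ⟩
    (ascWeight u v *ₚ fromℕₚ (L ∸ u) +ₚ ascWeight (suc u) v *ₚ fromℕₚ (suc u)) *ₚ z u
      ≈⟨ *-congʳ (ascWeight-spread L u v u<L v≤1+L) ⟩
    (fromℕₚ (suc L ∸ v) *ₚ ascWeight u v +ₚ fromℕₚ v *ₚ ascWeight u (v ∸ 1)) *ₚ z u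
      ≈⟨ factorʳ (fromℕₚ (suc L ∸ v)) (ascWeight u v) (fromℕₚ v) (ascWeight u (v ∸ 1)) (z u) ⟨
    fromℕₚ (suc L ∸ v) *ₚ (ascWeight u v *ₚ z u) +ₚ fromℕₚ v *ₚ (ascWeight u (v ∸ 1) *ₚ z u) ∎

spread-shiftedEulerianAt : ∀ d j v → v ≤ j + d →
  spread (j + d) (shiftedEulerianAt d j) v ≋ fromℕₚ d *ₚ shiftedEulerianAt (suc d) j v
spread-shiftedEulerianAt d zero v v≤d = begin
  fromℕₚ (d ∸ v) *ₚ 1ₚ +ₚ fromℕₚ v *ₚ 1ₚ  ≈⟨ +-cong (*-identityʳ (fromℕₚ (d ∸ v))) (*-identityʳ (fromℕₚ v)) ⟩
  fromℕₚ (d ∸ v) +ₚ fromℕₚ v              ≈⟨ fromℕₚ-split (d ∸ v) v d (ℕ.m∸n+n≡m v≤d) ⟩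
  fromℕₚ d                                 ≈⟨ *-identityʳ (fromℕₚ d) ⟨
  fromℕₚ d *ₚ 1ₚ                           ∎
spread-shiftedEulerianAt d (suc j) v v≤ = begin
  spread (suc (j + d)) (transfer (j + d) (shiftedEulerianAt d j)) v
    ≈⟨ transfer-spread (j + d) (shiftedEulerianAt d j) v v≤ ⟨
  transfer (suc (j + d)) (spread (j + d) (shiftedEulerianAt d j)) v
    ≈⟨ transfer-cong (suc (j + d)) (λ u u< → spread-shiftedEulerianAt d j u (ℕ.≤-pred u<)) v ⟩
  transfer (suc (j + d)) (λ u → fromℕₚ d *ₚ shiftedEulerianAt (suc d) j u) v
    ≈⟨ transfer-*ₚ (suc (j + d)) (fromℕₚ d) (shiftedEulerianAt (suc d) j) v ⟩
  fromℕₚ d *ₚ transfer (suc (j + d)) (shiftedEulerianAt (suc d) j) v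
    ≡⟨ ≡.cong (λ L → fromℕₚ d *ₚ transfer L (shiftedEulerianAt (suc d) j) v) (ℕ.+-suc j d) ⟨
  fromℕₚ d *ₚ shiftedEulerianAt (suc d) (suc j) v ∎

Σ-spread : ∀ L z → Σ (suc L) (spread L z) ≋ fromℕₚ (suc L) *ₚ Σ L z
Σ-spread L z = begin
  Σ (suc L) (λ v → left v +ₚ right v)  ≈⟨ Σ-distrib-+ (suc L) left right ⟩
  Σ (suc L) left +ₚ Σ (suc L) right    ≈⟨ +-cong (Σ-init L left lastLeft) (Σ-tail L right (fromℕₚ-0-*ₚ (z 0))) ⟩
  Σ L left +ₚ Σ L (right ∘ suc)        ≈⟨ Σ-distrib-+ L left (right ∘ suc) ⟨
  Σ L (λ v → left v +ₚ right (suc v))  ≈⟨ Σ-cong-< L merge ⟩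
  Σ L (λ v → fromℕₚ (suc L) *ₚ z v)    ≈⟨ *-distribˡ-Σ L (fromℕₚ (suc L)) z ⟨
  fromℕₚ (suc L) *ₚ Σ L z              ∎
  where
  left right : ℕ → Poly
  left  v = fromℕₚ (L ∸ v) *ₚ z v
  right v = fromℕₚ v *ₚ z (v ∸ 1)

  lastLeft : left L ≋ 0ₚ
  lastLeft = ≋-trans (≋-reflexive (≡.cong (λ k → fromℕₚ k *ₚ z L) (ℕ.n∸n≡0 L))) (fromℕₚ-0-*ₚ (z L))

  merge : ∀ v → v < L → left v +ₚ right (suc v) ≋ fromℕₚ (suc L) *ₚ z v
  merge v v<L = ≋-trans (≋-sym (distribʳ (z v) (fromℕₚ (L ∸ v)) (fromℕₚ (suc v))))
                        (*-congʳ (fromℕₚ-split (L ∸ v) (suc v) (suc L) ([m∸n]+[1+n]≡1+m v<L)))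

shiftedEulerian-step : ∀ d j →
  fromℕₚ d *ₚ shiftedEulerian (suc d) j ≋ fromℕₚ (suc (j + d)) *ₚ shiftedEulerian d j
shiftedEulerian-step d j = begin
  fromℕₚ d *ₚ Σ (j + suc d) (shiftedEulerianAt (suc d) j)
    ≈⟨ *-distribˡ-Σ (j + suc d) (fromℕₚ d) (shiftedEulerianAt (suc d) j) ⟩
  Σ (j + suc d) (λ v → fromℕₚ d *ₚ shiftedEulerianAt (suc d) j v)
    ≡⟨ ≡.cong (λ L → Σ L (λ v → fromℕₚ d *ₚ shiftedEulerianAt (suc d) j v)) (ℕ.+-suc j d) ⟩
  Σ (suc (j + d)) (λ v → fromℕₚ d *ₚ shiftedEulerianAt (suc d) j v)
    ≈⟨ Σ-cong-< (suc (j + d)) (λ v v< → spread-shiftedEulerianAt d j v (ℕ.≤-pred v<)) ⟨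
  Σ (suc (j + d)) (spread (j + d) (shiftedEulerianAt d j))
    ≈⟨ Σ-spread (j + d) (shiftedEulerianAt d j) ⟩
  fromℕₚ (suc (j + d)) *ₚ shiftedEulerian d j ∎

shiftedEulerian-binomial : ∀ d j →
  shiftedEulerian (suc d) j ≋ fromℕₚ ((j + suc d) C suc j) *ₚ shiftedEulerian 1 j
shiftedEulerian-binomial zero j = begin
  shiftedEulerian 1 j                                  ≈⟨ *-identityˡ _ ⟨
  1ₚ *ₚ shiftedEulerian 1 j                            ≈⟨ *-congʳ {shiftedEulerian 1 j} fromℕₚ-1 ⟨
  fromℕₚ 1 *ₚ shiftedEulerian 1 j                      ≡⟨ ≡.cong (λ m → fromℕₚ m *ₚ shiftedEulerian 1 j) 1≡C ⟩
  fromℕₚ ((j + 1) C suc j) *ₚ shiftedEulerian 1 j      ∎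
  where
  1≡C : 1 ≡ (j + 1) C suc j
  1≡C = ≡.trans (≡.sym (nCn≡1 (suc j))) (≡.cong (_C suc j) (ℕ.+-comm 1 j))
shiftedEulerian-binomial (suc d) j = fromℕₚ-*ₚ-cancel d _ _ (begin
  fromℕₚ (suc d) *ₚ shiftedEulerian (suc (suc d)) j
    ≈⟨ shiftedEulerian-step (suc d) j ⟩
  fromℕₚ (suc N) *ₚ shiftedEulerian (suc d) j
    ≈⟨ *-congˡ {fromℕₚ (suc N)} (shiftedEulerian-binomial d j) ⟩
  fromℕₚ (suc N) *ₚ (fromℕₚ (N C suc j) *ₚ shiftedEulerian 1 j)
    ≈⟨ fromℕₚ-*-assoc (suc N) (N C suc j) (shiftedEulerian 1 j) ⟨
  fromℕₚ (suc N * (N C suc j)) *ₚ shiftedEulerian 1 j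
    ≡⟨ ≡.cong (λ m → fromℕₚ m *ₚ shiftedEulerian 1 j) ([1+j+d]*[j+d]C[1+j]≡d*[1+j+d]C[1+j] (suc d) j) ⟩
  fromℕₚ (suc d * (suc N C suc j)) *ₚ shiftedEulerian 1 j
    ≈⟨ fromℕₚ-*-assoc (suc d) (suc N C suc j) (shiftedEulerian 1 j) ⟩
  fromℕₚ (suc d) *ₚ (fromℕₚ (suc N C suc j) *ₚ shiftedEulerian 1 j)
    ≡⟨ ≡.cong (λ m → fromℕₚ (suc d) *ₚ (fromℕₚ (m C suc j) *ₚ shiftedEulerian 1 j)) (ℕ.+-suc j (suc d)) ⟨
  fromℕₚ (suc d) *ₚ (fromℕₚ ((j + suc (suc d)) C suc j) *ₚ shiftedEulerian 1 j) ∎)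
  where
  N : ℕ
  N = j + suc d

punchIn : ℕ → ℕ → ℕ
punchIn a u = if u <ᵇ a then u else suc u

punchIn-< : ∀ {a u} → u < a → punchIn a u ≡ u
punchIn-< {u = u} u<a = ≡.cong (λ b → if b then u else suc u) (<ᵇ-true u<a)

punchIn-≥ : ∀ {a u} → a ≤ u → punchIn a u ≡ suc u
punchIn-≥ {u = u} a≤u = ≡.cong (λ b → if b then u else suc u) (<ᵇ-false a≤u)

punchIn-mono-< : ∀ a {x y} → y < x → punchIn a y < punchIn a x
punchIn-mono-< a {x} {y} y<x with y <? a | x <? a
... | yes y<a | yes x<a rewrite punchIn-< y<a | punchIn-< x<a = y<x
... | yes y<a | no x≮a  rewrite punchIn-< y<a | punchIn-≥ (ℕ.≮⇒≥ x≮a) = ℕ.m<n⇒m<1+n y<x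
... | no y≮a  | yes x<a = ⊥-elim (y≮a (ℕ.<-trans y<x x<a))
... | no y≮a  | no x≮a  rewrite punchIn-≥ (ℕ.≮⇒≥ y≮a) | punchIn-≥ (ℕ.≮⇒≥ x≮a) = s≤s y<x

punchIn-cancel-< : ∀ a {x y} → punchIn a y < punchIn a x → y < x
punchIn-cancel-< a {x} {y} lt with ℕ.<-cmp y x
... | tri< y<x _ _ = y<x
... | tri≈ _ ≡.refl _ = ⊥-elim (ℕ.<-irrefl ≡.refl lt)
... | tri> _ _ x<y = ⊥-elim (ℕ.<-asym lt (punchIn-mono-< a x<y))

punchIn-injective : ∀ a {x y} → punchIn a x ≡ punchIn a y → x ≡ y
punchIn-injective a {x} {y} eq with ℕ.<-cmp x y
... | tri< x<y _ _ = ⊥-elim (ℕ.<-irrefl eq (punchIn-mono-< a x<y))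
... | tri≈ _ x≡y _ = x≡y
... | tri> _ _ y<x = ⊥-elim (ℕ.<-irrefl (≡.sym eq) (punchIn-mono-< a y<x))

punchIn-<ᵇ : ∀ a x y → (punchIn a y <ᵇ punchIn a x) ≡ (y <ᵇ x)
punchIn-<ᵇ a x y = T-injective (λ t → ℕ.<⇒<ᵇ (punchIn-cancel-< a (ℕ.<ᵇ⇒< _ _ t)))
                               (λ t → ℕ.<⇒<ᵇ (punchIn-mono-< a (ℕ.<ᵇ⇒< _ _ t)))

punchIn-≡ᵇ : ∀ a x y → (punchIn a x ≡ᵇ punchIn a y) ≡ (x ≡ᵇ y)
punchIn-≡ᵇ a x y = T-injective (λ t → ℕ.≡⇒≡ᵇ x y (punchIn-injective a (ℕ.≡ᵇ⇒≡ _ _ t)))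
                               (λ t → ℕ.≡⇒≡ᵇ _ _ (≡.cong (punchIn a) (ℕ.≡ᵇ⇒≡ x y t)))

punchIn-<ᵇ-pivot : ∀ a b → (punchIn a b <ᵇ a) ≡ (b <ᵇ a)
punchIn-<ᵇ-pivot a b with b <? a
... | yes b<a rewrite punchIn-< b<a = ≡.refl
... | no b≮a  rewrite punchIn-≥ (ℕ.≮⇒≥ b≮a) =
  T-injective (λ t → ⊥-elim (b≮a (ℕ.<-trans (ℕ.n<1+n b) (ℕ.<ᵇ⇒< _ _ t))))
              (λ t → ⊥-elim (b≮a (ℕ.<ᵇ⇒< _ _ t)))

punchIn-≢ : ∀ a b → (a ≡ᵇ punchIn a b) ≡ false
punchIn-≢ a b = T-injective (λ t → ⊥-elim (differ (ℕ.≡ᵇ⇒≡ _ _ t))) (λ ())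
  where
  differ : a ≢ punchIn a b
  differ eq with b <? a
  ... | yes b<a = ℕ.<-irrefl (≡.trans (≡.sym (punchIn-< b<a)) (≡.sym eq)) b<a
  ... | no b≮a  = ℕ.<-irrefl (≡.trans eq (punchIn-≥ (ℕ.≮⇒≥ b≮a))) (s≤s (ℕ.≮⇒≥ b≮a))

elemᵇ-punchIn : ∀ a x τ → elemᵇ (punchIn a x) (map (punchIn a) τ) ≡ elemᵇ x τ
elemᵇ-punchIn a x []      = ≡.refl
elemᵇ-punchIn a x (y ∷ τ) rewrite punchIn-≡ᵇ a x y | elemᵇ-punchIn a x τ = ≡.refl

des-punchIn : ∀ a τ → des (map (punchIn a) τ) ≡ des τ
des-punchIn a []          = ≡.refl
des-punchIn a (x ∷ [])    = ≡.refl
des-punchIn a (x ∷ y ∷ τ) =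
  ≡.cong₂ (λ b r → (if b then 1 else 0) + r) (punchIn-<ᵇ a x y) (des-punchIn a (y ∷ τ))

sumMap-words-suc : ∀ (g : List ℕ → Poly) M l →
  sumMap g (words M (suc l)) ≋ Σ M (λ a → sumMap (g ∘ (a ∷_)) (words M l))
sumMap-words-suc g M l =
  ≋-trans (sumMap-concatMap g (λ a → map (a ∷_) (words M l)) (upTo M))
          (≋-trans (sumMap-upTo (λ a → sumMap g (map (a ∷_) (words M l))) M)
                   (Σ-cong M (λ a → ≋-reflexive (sumMap-map g (a ∷_) (words M l)))))

Σ-punchIn : ∀ M a (F : ℕ → Poly) → a ≤ M → F a ≋ 0ₚ → Σ (suc M) F ≋ Σ M (F ∘ punchIn a)
Σ-punchIn zero    .zero F z≤n Fa≋0 = ≋-trans (+-identityˡ _) Fa≋0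
Σ-punchIn (suc M) a     F a≤1+M Fa≋0 with a ℕ.≟ suc M
... | yes ≡.refl = ≋-trans (Σ-init (suc M) F Fa≋0)
                           (Σ-cong-< (suc M) (λ b b< → ≋-reflexive (≡.cong F (≡.sym (punchIn-< b<)))))
... | no a≢1+M   = +-cong (Σ-punchIn M a F a≤M Fa≋0) (≋-reflexive (≡.cong F (≡.sym (punchIn-≥ a≤M))))
  where
  a≤M : a ≤ M
  a≤M = ℕ.≤-pred (ℕ.≤∧≢⇒< a≤1+M a≢1+M)

whenₚ-∧-∧ : ∀ x y z p → whenₚ (x ∧ (y ∧ z)) p ≡ whenₚ (x ∧ z) (whenₚ y p)
whenₚ-∧-∧ false y     z     p = ≡.refl
whenₚ-∧-∧ true  false true  p = ≡.refl
whenₚ-∧-∧ true  false false p = ≡.refl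
whenₚ-∧-∧ true  true  z     p = ≡.refl

whenₚ-∧ : ∀ x y p → whenₚ (x ∧ y) p ≡ whenₚ y (whenₚ x p)
whenₚ-∧ false false p = ≡.refl
whenₚ-∧ false true  p = ≡.refl
whenₚ-∧ true  y     p = ≡.refl

≡ᵇ-refl : ∀ a → (a ≡ᵇ a) ≡ true
≡ᵇ-refl a = T-injective (λ _ → _) (λ _ → ℕ.≡⇒≡ᵇ a a ≡.refl)

Σdistinct : ℕ → ℕ → (List ℕ → Poly) → Poly
Σdistinct M l h = sumMap (λ w → whenₚ (distinctᵇ w) (h w)) (words M l)

Σdistinct-cong : ∀ M l {h h′} → (∀ w → h w ≋ h′ w) → Σdistinct M l h ≋ Σdistinct M l h′
Σdistinct-cong M l h≋h′ = sumMap-cong (words M l) (λ w → whenₚ-cong (distinctᵇ w) (h≋h′ w))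

Σdistinct-*ₚ : ∀ M l c h → Σdistinct M l (λ w → c *ₚ h w) ≋ c *ₚ Σdistinct M l h
Σdistinct-*ₚ M l c h =
  ≋-trans (sumMap-cong (words M l) (λ w → whenₚ-*ₚ (distinctᵇ w) c (h w)))
          (≋-sym (*-distribˡ-sumMap c (λ w → whenₚ (distinctᵇ w) (h w)) (words M l)))

-- Words over {0, …, M} avoiding a letter a are the images under punchIn a of words over {0, …, M - 1}.
Σdistinct-avoiding : ∀ M l a (h : List ℕ → Poly) → a ≤ M →
  sumMap (λ w → whenₚ (not (elemᵇ a w) ∧ distinctᵇ w) (h w)) (words (suc M) l)
    ≋ Σdistinct M l (h ∘ map (punchIn a))
Σdistinct-avoiding M zero    a h a≤M = ≋-refl
Σdistinct-avoiding M (suc l) a h a≤M = begin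
  sumMap (λ w → whenₚ (not (elemᵇ a w) ∧ distinctᵇ w) (h w)) (words (suc M) (suc l))
    ≈⟨ sumMap-words-suc (λ w → whenₚ (not (elemᵇ a w) ∧ distinctᵇ w) (h w)) (suc M) l ⟩
  Σ (suc M) byFirst
    ≈⟨ Σ-punchIn M a byFirst a≤M firstIsA ⟩
  Σ M (byFirst ∘ punchIn a)
    ≈⟨ Σ-cong M firstIsNotA ⟩
  Σ M (λ b → sumMap (λ τ → whenₚ (distinctᵇ (b ∷ τ)) (h (map (punchIn a) (b ∷ τ)))) (words M l))
    ≈⟨ sumMap-words-suc (λ τ → whenₚ (distinctᵇ τ) (h (map (punchIn a) τ))) M l ⟨
  Σdistinct M (suc l) (h ∘ map (punchIn a)) ∎
  where
  byFirst : ℕ → Poly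
  byFirst b = sumMap (λ w → whenₚ (not (elemᵇ a (b ∷ w)) ∧ distinctᵇ (b ∷ w)) (h (b ∷ w))) (words (suc M) l)

  firstIsA : byFirst a ≋ 0ₚ
  firstIsA = ≋-trans (sumMap-cong (words (suc M) l) (λ w → ≋-reflexive
                       (≡.cong (λ t → whenₚ (not (if t then true else elemᵇ a w) ∧ distinctᵇ (a ∷ w)) (h (a ∷ w)))
                               (≡ᵇ-refl a))))
                     (sumMap-zero (words (suc M) l))

  firstIsNotA : ∀ b′ → byFirst (punchIn a b′) ≋
    sumMap (λ τ → whenₚ (distinctᵇ (b′ ∷ τ)) (h (map (punchIn a) (b′ ∷ τ)))) (words M l)
  firstIsNotA b′ = begin
    byFirst b
      ≈⟨ sumMap-cong (words (suc M) l) (λ w → ≋-reflexive (≡.trans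
           (≡.cong (λ t → whenₚ (not (if t then true else elemᵇ a w) ∧ distinctᵇ (b ∷ w)) (h (b ∷ w)))
                   (punchIn-≢ a b′))
           (whenₚ-∧-∧ (not (elemᵇ a w)) (not (elemᵇ b w)) (distinctᵇ w) (h (b ∷ w))))) ⟩
    sumMap (λ w → whenₚ (not (elemᵇ a w) ∧ distinctᵇ w) (whenₚ (not (elemᵇ b w)) (h (b ∷ w)))) (words (suc M) l)
      ≈⟨ Σdistinct-avoiding M l a (λ w → whenₚ (not (elemᵇ b w)) (h (b ∷ w))) a≤M ⟩
    Σdistinct M l (λ τ → whenₚ (not (elemᵇ b (map (punchIn a) τ))) (h (b ∷ map (punchIn a) τ)))
      ≈⟨ sumMap-cong (words M l) (λ τ → ≋-reflexive (≡.trans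
           (≡.cong (λ t → whenₚ (distinctᵇ τ) (whenₚ (not t) (h (b ∷ map (punchIn a) τ)))) (elemᵇ-punchIn a b′ τ))
           (≡.sym (whenₚ-∧ (not (elemᵇ b′ τ)) (distinctᵇ τ) (h (b ∷ map (punchIn a) τ)))))) ⟩
    sumMap (λ τ → whenₚ (distinctᵇ (b′ ∷ τ)) (h (map (punchIn a) (b′ ∷ τ)))) (words M l) ∎
    where
    b : ℕ
    b = punchIn a b′

Σdistinct-first : ∀ m (g : List ℕ → Poly) →
  Σdistinct (suc m) (suc m) g ≋ Σ (suc m) (λ a → Σdistinct m m (λ τ → g (a ∷ map (punchIn a) τ)))
Σdistinct-first m g =
  ≋-trans (sumMap-words-suc (λ w → whenₚ (distinctᵇ w) (g w)) (suc m) m)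
          (Σ-cong-< (suc m) (λ a a< → Σdistinct-avoiding m m a (λ w → g (a ∷ w)) (ℕ.≤-pred a<)))

eulerianFrom : ℕ → ℕ → Poly
eulerianFrom m a = Σdistinct m m (λ τ → Xₚ ^ₚ des (a ∷ map (punchIn a) τ))

Eulerian-suc : ∀ m → Eulerian (suc m) ≋ Σ (suc m) (eulerianFrom m)
Eulerian-suc m = ≋-trans (sumMap-filterᵇ (λ σ → Xₚ ^ₚ des σ) distinctᵇ (words (suc m) (suc m)))
                         (Σdistinct-first m (λ σ → Xₚ ^ₚ des σ))

Xₚ^-if : ∀ t d → Xₚ ^ₚ ((if t then 1 else 0) + d) ≋ (if t then Xₚ else 1ₚ) *ₚ Xₚ ^ₚ d
Xₚ^-if true  d = ≋-refl
Xₚ^-if false d = ≋-sym (*-identityˡ _)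

eulerianFrom-suc : ∀ m a → eulerianFrom (suc m) a ≋ transfer (suc m) (eulerianFrom m) a
eulerianFrom-suc m a =
  ≋-trans (Σdistinct-first m (λ τ → Xₚ ^ₚ des (a ∷ map (punchIn a) τ)))
          (Σ-cong (suc m) (λ b → ≋-trans (Σdistinct-cong m m (firstDescent b))
                                         (Σdistinct-*ₚ m m (ascWeight b a) _)))
  where
  firstDescent : ∀ b ρ → Xₚ ^ₚ des (a ∷ map (punchIn a) (b ∷ map (punchIn b) ρ))
                         ≋ ascWeight b a *ₚ Xₚ ^ₚ des (b ∷ map (punchIn b) ρ)
  firstDescent b ρ = ≋-trans
    (≋-reflexive (≡.cong₂ (λ t r → Xₚ ^ₚ ((if t then 1 else 0) + r))
                          (punchIn-<ᵇ-pivot a b) (des-punchIn a (b ∷ map (punchIn b) ρ))))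
    (Xₚ^-if (b <ᵇ a) (des (b ∷ map (punchIn b) ρ)))

eulerianFrom≋shiftedEulerianAt : ∀ m a → eulerianFrom m a ≋ shiftedEulerianAt 1 m a
eulerianFrom≋shiftedEulerianAt zero    a = +-identityʳ 1ₚ
eulerianFrom≋shiftedEulerianAt (suc m) a =
  ≋-trans (eulerianFrom-suc m a)
  (≋-trans (transfer-cong (suc m) (λ u _ → eulerianFrom≋shiftedEulerianAt m u) a)
           (≋-reflexive (≡.cong (λ L → transfer L (shiftedEulerianAt 1 m) a) (ℕ.+-comm 1 m))))

Eulerian≋shiftedEulerian : ∀ m → Eulerian (suc m) ≋ shiftedEulerian 1 m
Eulerian≋shiftedEulerian m =
  ≋-trans (Eulerian-suc m)
  (≋-trans (Σ-cong (suc m) (eulerianFrom≋shiftedEulerianAt m))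
           (≋-reflexive (≡.cong (λ L → Σ L (shiftedEulerianAt 1 m)) (ℕ.+-comm 1 m))))

stepWeight : ℕ → ℕ → Poly
stepWeight p a = if p <ᵇ a then Xₚ else (if (p ≡ᵇ 0) ∧ (a ≡ᵇ 0) then 1+x else 1ₚ)

pairWeight : ℕ × ℕ → ℕ × ℕ → Poly
pairWeight p q = if ascᵇ p q then Xₚ else (if colᵇ p q then 1+x else 1ₚ)

adjWeight : List (ℕ × ℕ) → Poly
adjWeight ps = (1+x ^ₚ countAdj colᵇ ps) *ₚ (Xₚ ^ₚ countAdj ascᵇ ps)

ascᵇ-colᵇ-exclusive : ∀ p q → ascᵇ p q ≡ true → colᵇ p q ≡ true → ⊥
ascᵇ-colᵇ-exclusive (e , s) (e′ , s′) asc col =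
  ℕ.<-irrefl (ℕ.≡ᵇ⇒≡ (e * s′) (e′ * s) (≡.subst T (≡.sym col) _))
             (ℕ.<ᵇ⇒< (e * s′) (e′ * s) (≡.subst T (≡.sym asc) _))

adjWeight-∷ : ∀ p q r → adjWeight (p ∷ q ∷ r) ≋ pairWeight p q *ₚ adjWeight (q ∷ r)
adjWeight-∷ p q r with ascᵇ p q in asc | colᵇ p q in col
... | true  | true  = ⊥-elim (ascᵇ-colᵇ-exclusive p q asc col)
... | true  | false = x∙yz≈y∙xz (1+x ^ₚ countAdj colᵇ (q ∷ r)) Xₚ (Xₚ ^ₚ countAdj ascᵇ (q ∷ r))
... | false | true  = *-assoc 1+x (1+x ^ₚ countAdj colᵇ (q ∷ r)) (Xₚ ^ₚ countAdj ascᵇ (q ∷ r))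
... | false | false = ≋-sym (*-identityˡ _)

e*[1+s]<e′*s : ∀ {e s e′} → e < s → e < e′ → e * suc s < e′ * s
e*[1+s]<e′*s {e} {s} e<s e<e′ =
  ℕ.<-≤-trans (≡.subst (_< suc e * s) (≡.sym (ℕ.*-suc e s)) (ℕ.+-monoˡ-< (e * s) e<s)) (ℕ.*-monoˡ-≤ s e<e′)

e′*s≤e*[1+s] : ∀ {e s e′} → e′ ≤ e → e′ * s ≤ e * suc s
e′*s≤e*[1+s] {e} {s} e′≤e =
  ℕ.≤-trans (ℕ.*-monoˡ-≤ s e′≤e) (≡.subst (e * s ≤_) (≡.sym (ℕ.*-suc e s)) (ℕ.m≤n+m (e * s) e))

ascᵇ-consecutive : ∀ e s e′ → e < s → ascᵇ (e , s) (e′ , suc s) ≡ (e <ᵇ e′)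
ascᵇ-consecutive e s e′ e<s =
  T-injective (λ t → ℕ.<⇒<ᵇ (cancel (ℕ.<ᵇ⇒< (e * suc s) (e′ * s) t)))
              (λ t → ℕ.<⇒<ᵇ (e*[1+s]<e′*s e<s (ℕ.<ᵇ⇒< e e′ t)))
  where
  cancel : e * suc s < e′ * s → e < e′
  cancel lt with e <? e′
  ... | yes e<e′ = e<e′
  ... | no e≮e′  = ⊥-elim (ℕ.<⇒≱ lt (e′*s≤e*[1+s] (ℕ.≮⇒≥ e≮e′)))

colᵇ-consecutive : ∀ e s e′ → e < s → colᵇ (e , s) (e′ , suc s) ≡ ((e ≡ᵇ 0) ∧ (e′ ≡ᵇ 0))
colᵇ-consecutive zero    (suc s) zero     _   = ≡.refl
colᵇ-consecutive zero    (suc s) (suc e′) _   = ≡.refl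
colᵇ-consecutive (suc e) s       e′       e<s =
  T-injective (λ t → ⊥-elim (differ (ℕ.≡ᵇ⇒≡ (suc e * suc s) (e′ * s) t))) (λ ())
  where
  differ : suc e * suc s ≢ e′ * s
  differ eq with suc e <? e′
  ... | yes 1+e<e′ = ℕ.<-irrefl eq (e*[1+s]<e′*s e<s 1+e<e′)
  ... | no 1+e≮e′  = ℕ.<-irrefl (≡.sym eq)
                       (ℕ.≤-<-trans (ℕ.*-monoˡ-≤ s (ℕ.≮⇒≥ 1+e≮e′)) (ℕ.*-monoʳ-< (suc e) (ℕ.n<1+n s)))

-- The pairs (e_{i-1}, s_{i-1}) that can precede a box of size c.
data Admissible : ℕ × ℕ → ℕ → Set where
  initial : ∀ {s c} → Admissible (0 , suc s) c
  interior : ∀ {e s} → e < s → Admissible (e , s) (suc s)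

pairWeight-admissible : ∀ {e s c} a → Admissible (e , s) c → pairWeight (e , s) (a , c) ≡ stepWeight e a
pairWeight-admissible {s = suc s} zero    initial = ≡.refl
pairWeight-admissible {s = suc s} (suc a) initial = ≡.refl
pairWeight-admissible {e} {s} a (interior e<s) =
  ≡.cong₂ (λ t u → if t then Xₚ else (if u then 1+x else 1ₚ))
          (ascᵇ-consecutive e s a e<s) (colᵇ-consecutive e s a e<s)

pairWeight-end : ∀ e s → pairWeight (e , s) (0 , 1) ≡ stepWeight e 0
pairWeight-end zero    s = ≡.refl
pairWeight-end (suc e) s = ≡.refl

consecutive : ℕ → ℕ → List ℕ
consecutive c zero    = []
consecutive c (suc l) = c ∷ consecutive (suc c) l

pathSum : ℕ → ℕ → ℕ → (ℕ → Poly) → Poly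
pathSum p c zero    f = f p
pathSum p c (suc l) f = Σ c (λ a → stepWeight p a *ₚ pathSum a (suc c) l f)

closingWeight : ℕ → Poly
closingWeight a = stepWeight a 0

boxSum : ℕ × ℕ → ℕ → ℕ → Poly
boxSum p c l = sumMap (λ e → adjWeight (p ∷ (zipL e (consecutive c l) ++ (0 , 1) ∷ []))) (boxes (consecutive c l))

boxSum≋pathSum : ∀ l c {e s} → Admissible (e , s) c → boxSum (e , s) c l ≋ pathSum e c l closingWeight
boxSum≋pathSum zero c {e} {s} _ = begin
  adjWeight ((e , s) ∷ (0 , 1) ∷ []) +ₚ 0ₚ             ≈⟨ +-identityʳ _ ⟩
  adjWeight ((e , s) ∷ (0 , 1) ∷ [])                   ≈⟨ adjWeight-∷ (e , s) (0 , 1) [] ⟩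
  pairWeight (e , s) (0 , 1) *ₚ (1ₚ *ₚ 1ₚ)             ≈⟨ *-congˡ {pairWeight (e , s) (0 , 1)} (*-identityˡ 1ₚ) ⟩
  pairWeight (e , s) (0 , 1) *ₚ 1ₚ                     ≈⟨ *-identityʳ _ ⟩
  pairWeight (e , s) (0 , 1)                           ≡⟨ pairWeight-end e s ⟩
  stepWeight e 0                                       ∎
boxSum≋pathSum (suc l) c {e} {s} adm = begin
  boxSum (e , s) c (suc l)
    ≈⟨ sumMap-concatMap term (λ a → map (a ∷_) (boxes (consecutive (suc c) l))) (upTo c) ⟩
  sumMap (λ a → sumMap term (map (a ∷_) (boxes (consecutive (suc c) l)))) (upTo c)
    ≈⟨ sumMap-upTo (λ a → sumMap term (map (a ∷_) (boxes (consecutive (suc c) l)))) c ⟩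
  Σ c (λ a → sumMap term (map (a ∷_) (boxes (consecutive (suc c) l))))
    ≈⟨ Σ-cong-< c byFirst ⟩
  pathSum e c (suc l) closingWeight ∎
  where
  term : List ℕ → Poly
  term es = adjWeight ((e , s) ∷ (zipL es (consecutive c (suc l)) ++ (0 , 1) ∷ []))

  byFirst : ∀ a → a < c → sumMap term (map (a ∷_) (boxes (consecutive (suc c) l)))
                          ≋ stepWeight e a *ₚ pathSum a (suc c) l closingWeight
  byFirst a a<c = begin
    sumMap term (map (a ∷_) (boxes (consecutive (suc c) l)))
      ≡⟨ sumMap-map term (a ∷_) (boxes (consecutive (suc c) l)) ⟩
    sumMap (term ∘ (a ∷_)) (boxes (consecutive (suc c) l))
      ≈⟨ sumMap-cong (boxes (consecutive (suc c) l))
           (λ es → adjWeight-∷ (e , s) (a , c) (zipL es (consecutive (suc c) l) ++ (0 , 1) ∷ [])) ⟩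
    sumMap (λ es → pairWeight (e , s) (a , c) *ₚ adjWeight ((a , c) ∷ (zipL es (consecutive (suc c) l) ++ (0 , 1) ∷ [])))
           (boxes (consecutive (suc c) l))
      ≈⟨ *-distribˡ-sumMap (pairWeight (e , s) (a , c)) _ (boxes (consecutive (suc c) l)) ⟨
    pairWeight (e , s) (a , c) *ₚ boxSum (a , c) (suc c) l
      ≈⟨ *-cong (≋-reflexive (pairWeight-admissible a adm)) (boxSum≋pathSum l (suc c) (interior a<c)) ⟩
    stepWeight e a *ₚ pathSum a (suc c) l closingWeight ∎

applyUpTo≡consecutive : ∀ (h : ℕ → ℕ) c l → (∀ j → h j ≡ c + j) → applyUpTo h l ≡ consecutive c l
applyUpTo≡consecutive h c zero    h≗c+ = ≡.refl
applyUpTo≡consecutive h c (suc l) h≗c+ =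
  ≡.cong₂ _∷_ (≡.trans (h≗c+ 0) (ℕ.+-identityʳ c))
              (applyUpTo≡consecutive (h ∘ suc) (suc c) l (λ j → ≡.trans (h≗c+ (suc j)) (ℕ.+-suc c j)))

sVec≡consecutive : ∀ m n → sVec (suc (suc m)) n ≡ consecutive (n ∸ suc (suc m) + 2) (suc m)
sVec≡consecutive m n =
  ≡.trans (map-applyUpTo (λ j → j) _ (suc m)) (applyUpTo≡consecutive _ _ (suc m) (λ j → ≡.refl))

E≋pathSum : ∀ m n → E (suc (suc m)) n ≋ pathSum 0 (n ∸ suc (suc m) + 2) (suc m) closingWeight
E≋pathSum m n = ≡.subst (λ s → sumₚ (map (Eterm s) (boxes s)) ≋ pathSum 0 c (suc m) closingWeight)
                        (≡.sym (sVec≡consecutive m n)) (boxSum≋pathSum (suc m) c initial)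
  where
  c : ℕ
  c = n ∸ suc (suc m) + 2

pathSumTo : ℕ → ℕ → ℕ → ℕ → Poly
pathSumTo p c zero    a = stepWeight p a
pathSumTo p c (suc l) a = Σ (c + l) (λ a′ → pathSumTo p c l a′ *ₚ stepWeight a′ a)

pathSumTo-first : ∀ l p c b →
  pathSumTo p c (suc l) b ≋ Σ c (λ a → stepWeight p a *ₚ pathSumTo a (suc c) l b)
pathSumTo-first zero    p c b =
  ≋-reflexive (≡.cong (λ N → Σ N (λ a → stepWeight p a *ₚ stepWeight a b)) (ℕ.+-identityʳ c))
pathSumTo-first (suc l) p c b = begin
  Σ (c + suc l) (λ a′ → pathSumTo p c (suc l) a′ *ₚ stepWeight a′ b)
    ≈⟨ Σ-cong (c + suc l) (λ a′ → *-congʳ (pathSumTo-first l p c a′)) ⟩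
  Σ (c + suc l) (λ a′ → Σ c (λ a → stepWeight p a *ₚ pathSumTo a (suc c) l a′) *ₚ stepWeight a′ b)
    ≈⟨ Σ-*-Σ c (c + suc l) (stepWeight p) (λ a a′ → pathSumTo a (suc c) l a′) (λ a′ → stepWeight a′ b) ⟩
  Σ c (λ a → stepWeight p a *ₚ Σ (c + suc l) (λ a′ → pathSumTo a (suc c) l a′ *ₚ stepWeight a′ b))
    ≡⟨ ≡.cong (λ N → Σ c (λ a → stepWeight p a *ₚ Σ N (λ a′ → pathSumTo a (suc c) l a′ *ₚ stepWeight a′ b)))
              (ℕ.+-suc c l) ⟩
  Σ c (λ a → stepWeight p a *ₚ pathSumTo a (suc c) (suc l) b) ∎

pathSum-last : ∀ l p c f → pathSum p c (suc l) f ≋ Σ (c + l) (λ a → pathSumTo p c l a *ₚ f a)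
pathSum-last zero    p c f =
  ≋-reflexive (≡.cong (λ N → Σ N (λ a → stepWeight p a *ₚ f a)) (≡.sym (ℕ.+-identityʳ c)))
pathSum-last (suc l) p c f = begin
  Σ c (λ a → stepWeight p a *ₚ pathSum a (suc c) (suc l) f)
    ≈⟨ Σ-cong c (λ a → *-congˡ {stepWeight p a} (pathSum-last l a (suc c) f)) ⟩
  Σ c (λ a → stepWeight p a *ₚ Σ (suc c + l) (λ b → pathSumTo a (suc c) l b *ₚ f b))
    ≡⟨ ≡.cong (λ N → Σ c (λ a → stepWeight p a *ₚ Σ N (λ b → pathSumTo a (suc c) l b *ₚ f b)))
              (≡.sym (ℕ.+-suc c l)) ⟩
  Σ c (λ a → stepWeight p a *ₚ Σ (c + suc l) (λ b → pathSumTo a (suc c) l b *ₚ f b))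
    ≈⟨ Σ-*-Σ c (c + suc l) (stepWeight p) (λ a b → pathSumTo a (suc c) l b) f ⟨
  Σ (c + suc l) (λ b → Σ c (λ a → stepWeight p a *ₚ pathSumTo a (suc c) l b) *ₚ f b)
    ≈⟨ Σ-cong (c + suc l) (λ b → *-congʳ (pathSumTo-first l p c b)) ⟨
  Σ (c + suc l) (λ b → pathSumTo p c (suc l) b *ₚ f b) ∎

-- diagonal c′ k = E_{k, k + c′ - 1}: along a diagonal n - k is fixed, hence so is the first box size c′ + 1.
diagonal : ℕ → ℕ → Poly
diagonal c′ zero    = 1ₚ
diagonal c′ (suc i) = pathSum 0 (suc c′) i closingWeight

Σ-scaled-*-Σ : ∀ N M x g (t : ℕ → ℕ → Poly) k →
  Σ N (λ u → (x *ₚ Σ M (λ i → g i *ₚ t i u)) *ₚ k u) ≋ x *ₚ Σ M (λ i → g i *ₚ Σ N (λ u → k u *ₚ t i u))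
Σ-scaled-*-Σ N M x g t k = begin
  Σ N (λ u → (x *ₚ Σ M (λ i → g i *ₚ t i u)) *ₚ k u)   ≈⟨ Σ-cong N (λ u → *-assoc x _ (k u)) ⟩
  Σ N (λ u → x *ₚ (Σ M (λ i → g i *ₚ t i u) *ₚ k u))   ≈⟨ *-distribˡ-Σ N x _ ⟨
  x *ₚ Σ N (λ u → Σ M (λ i → g i *ₚ t i u) *ₚ k u)     ≈⟨ *-congˡ {x} (Σ-*-Σ M N g t k) ⟩
  x *ₚ Σ M (λ i → g i *ₚ Σ N (λ u → t i u *ₚ k u))     ≈⟨ *-congˡ {x} (Σ-cong M (λ i →
                                                             *-congˡ {g i} (Σ-cong N (λ u → *-comm (t i u) (k u))))) ⟩
  x *ₚ Σ M (λ i → g i *ₚ Σ N (λ u → k u *ₚ t i u))     ∎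

[c+l]≡[l∸i]+[c+i] : ∀ c l i → i ≤ l → c + l ≡ (l ∸ i) + (c + i)
[c+l]≡[l∸i]+[c+i] c l i i≤l =
  ≡.trans (≡.cong (_+_ c) (≡.sym (ℕ.m∸n+n≡m i≤l)))
          (CommSemigroupProperties.x∙yz≈y∙xz ℕ.+-commutativeSemigroup c (l ∸ i) i)

module _ (c′ : ℕ) where

  private
    c : ℕ
    c = suc c′

    G : ℕ → Poly
    G = diagonal c′

    ending : ℕ → ℕ → ℕ → Poly
    ending l i = shiftedEulerianAt (c′ + i) (l ∸ i)

  pathSumTo-0 : ∀ l → pathSumTo 0 c l 0 ≋ G (suc l)
  pathSumTo-0 zero    = ≋-refl
  pathSumTo-0 (suc l) = ≋-sym (pathSum-last l 0 c closingWeight)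

  -- Split the path at its last visit i to 0: the later values are positive, and after
  -- lowering them by one only their ascents carry weight.
  pathSumTo-suc : ∀ l v → pathSumTo 0 c l (suc v) ≋ Xₚ *ₚ Σ (suc l) (λ i → G i *ₚ ending l i v)
  pathSumTo-suc zero    v =
    ≋-sym (≋-trans (*-congˡ {Xₚ} (≋-trans (+-identityˡ _) (*-identityˡ 1ₚ))) (*-identityʳ Xₚ))
  pathSumTo-suc (suc l) v = begin
    Σ (suc (c′ + l)) (λ a′ → pathSumTo 0 c l a′ *ₚ stepWeight a′ (suc v))
      ≈⟨ Σ-head (c′ + l) (λ a′ → pathSumTo 0 c l a′ *ₚ stepWeight a′ (suc v)) ⟩
    pathSumTo 0 c l 0 *ₚ Xₚ +ₚ Σ (c′ + l) (λ u → pathSumTo 0 c l (suc u) *ₚ ascWeight u v)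
      ≈⟨ +-cong (*-congʳ (pathSumTo-0 l)) (Σ-cong (c′ + l) (λ u → *-congʳ (pathSumTo-suc l u))) ⟩
    G (suc l) *ₚ Xₚ +ₚ Σ (c′ + l) (λ u → (Xₚ *ₚ Σ (suc l) (λ i → G i *ₚ ending l i u)) *ₚ ascWeight u v)
      ≈⟨ +-congˡ {G (suc l) *ₚ Xₚ} (Σ-scaled-*-Σ (c′ + l) (suc l) Xₚ G (ending l) (λ u → ascWeight u v)) ⟩
    G (suc l) *ₚ Xₚ +ₚ Xₚ *ₚ Σ (suc l) (λ i → G i *ₚ transfer (c′ + l) (ending l i) v)
      ≈⟨ +-cong (*-comm (G (suc l)) Xₚ) (*-congˡ {Xₚ} (Σ-cong-< (suc l) (λ i i≤l →
           *-congˡ {G i} (≋-reflexive (extend i (ℕ.≤-pred i≤l)))))) ⟩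
    Xₚ *ₚ G (suc l) +ₚ Xₚ *ₚ Σ (suc l) (λ i → G i *ₚ ending (suc l) i v)
      ≈⟨ distribˡ Xₚ (G (suc l)) (Σ (suc l) (λ i → G i *ₚ ending (suc l) i v)) ⟨
    Xₚ *ₚ (G (suc l) +ₚ Σ (suc l) (λ i → G i *ₚ ending (suc l) i v))
      ≈⟨ *-congˡ {Xₚ} (≋-trans (+-comm (G (suc l)) (Σ (suc l) (λ i → G i *ₚ ending (suc l) i v)))
                               (+-congˡ {Σ (suc l) (λ i → G i *ₚ ending (suc l) i v)} lastVisit)) ⟩
    Xₚ *ₚ Σ (suc (suc l)) (λ i → G i *ₚ ending (suc l) i v) ∎
    where
    extend : ∀ i → i ≤ l → transfer (c′ + l) (ending l i) v ≡ ending (suc l) i v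
    extend i i≤l = ≡.trans (≡.cong (λ N → transfer N (ending l i) v) ([c+l]≡[l∸i]+[c+i] c′ l i i≤l))
                           (≡.cong (λ j → shiftedEulerianAt (c′ + i) j v) (≡.sym (ℕ.+-∸-assoc 1 i≤l)))

    lastVisit : G (suc l) ≋ G (suc l) *ₚ ending (suc l) (suc l) v
    lastVisit = ≋-sym (≋-trans
      (≋-reflexive (≡.cong (λ j → G (suc l) *ₚ shiftedEulerianAt (c′ + suc l) j v) (ℕ.n∸n≡0 l)))
      (*-identityʳ (G (suc l))))

  diagonal-recurrence : ∀ k →
    G (suc (suc k)) ≋ 1+x *ₚ G (suc k) +ₚ Xₚ *ₚ Σ (suc k) (λ i → G i *ₚ shiftedEulerian (c′ + i) (k ∸ i))
  diagonal-recurrence k = begin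
    pathSum 0 c (suc k) closingWeight
      ≈⟨ pathSum-last k 0 c closingWeight ⟩
    Σ (suc (c′ + k)) (λ a → pathSumTo 0 c k a *ₚ closingWeight a)
      ≈⟨ Σ-head (c′ + k) (λ a → pathSumTo 0 c k a *ₚ closingWeight a) ⟩
    pathSumTo 0 c k 0 *ₚ 1+x +ₚ Σ (c′ + k) (λ u → pathSumTo 0 c k (suc u) *ₚ 1ₚ)
      ≈⟨ +-cong (≋-trans (*-congʳ (pathSumTo-0 k)) (*-comm (G (suc k)) 1+x))
                (Σ-cong (c′ + k) (λ u → *-congʳ (pathSumTo-suc k u))) ⟩
    1+x *ₚ G (suc k) +ₚ Σ (c′ + k) (λ u → (Xₚ *ₚ Σ (suc k) (λ i → G i *ₚ ending k i u)) *ₚ 1ₚ)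
      ≈⟨ +-congˡ {1+x *ₚ G (suc k)} (Σ-scaled-*-Σ (c′ + k) (suc k) Xₚ G (ending k) (λ _ → 1ₚ)) ⟩
    1+x *ₚ G (suc k) +ₚ Xₚ *ₚ Σ (suc k) (λ i → G i *ₚ Σ (c′ + k) (λ u → 1ₚ *ₚ ending k i u))
      ≈⟨ +-congˡ {1+x *ₚ G (suc k)} (*-congˡ {Xₚ} (Σ-cong-< (suc k) (λ i i≤k →
           *-congˡ {G i} (total i (ℕ.≤-pred i≤k))))) ⟩
    1+x *ₚ G (suc k) +ₚ Xₚ *ₚ Σ (suc k) (λ i → G i *ₚ shiftedEulerian (c′ + i) (k ∸ i)) ∎
    where
    total : ∀ i → i ≤ k → Σ (c′ + k) (λ u → 1ₚ *ₚ ending k i u) ≋ shiftedEulerian (c′ + i) (k ∸ i)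
    total i i≤k = ≋-trans (Σ-cong (c′ + k) (λ u → *-identityˡ (ending k i u)))
                          (≋-reflexive (≡.cong (λ N → Σ N (ending k i)) ([c+l]≡[l∸i]+[c+i] c′ k i i≤k)))

scaleₚ≋fromℕₚ-*ₚ : ∀ m p → scaleₚ (+ m) p ≋ fromℕₚ m *ₚ p
scaleₚ≋fromℕₚ-*ₚ m p = mk≋ (λ i → ≡.sym (fromℕₚ-*ₚ m p i))

Eulerian-0 : Eulerian 0 ≋ 1ₚ
Eulerian-0 = +-identityʳ 1ₚ

recRHS-term-0 : ∀ n p → scaleₚ (+ (n C 0)) (Eulerian 0 *ₚ p) ≋ p
recRHS-term-0 n p = begin
  scaleₚ (+ 1) (Eulerian 0 *ₚ p)  ≈⟨ scaleₚ≋fromℕₚ-*ₚ 1 _ ⟩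
  fromℕₚ 1 *ₚ (Eulerian 0 *ₚ p)   ≈⟨ *-congʳ {Eulerian 0 *ₚ p} fromℕₚ-1 ⟩
  1ₚ *ₚ (Eulerian 0 *ₚ p)         ≈⟨ *-identityˡ _ ⟩
  Eulerian 0 *ₚ p                 ≈⟨ *-congʳ {p} Eulerian-0 ⟩
  1ₚ *ₚ p                         ≈⟨ *-identityˡ p ⟩
  p                               ∎

E≋diagonal : ∀ k n → E k n ≋ diagonal (suc (n ∸ k)) k
E≋diagonal zero                n = ≋-refl
E≋diagonal (suc zero)          n = ≋-refl
E≋diagonal (suc (suc m)) n =
  ≋-trans (E≋pathSum m n)
          (≋-reflexive (≡.cong (λ c → pathSum 0 c (suc m) closingWeight) (ℕ.+-comm (n ∸ suc (suc m)) 2)))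

[n∸j]∸[k∸j]≡n∸k : ∀ n {j k} → j ≤ k → (n ∸ j) ∸ (k ∸ j) ≡ n ∸ k
[n∸j]∸[k∸j]≡n∸k n {j} {k} j≤k = ≡.trans (ℕ.∸-+-assoc n j (k ∸ j)) (≡.cong (n ∸_) (ℕ.m+[n∸m]≡n j≤k))

[k∸i]+[1+[n∸1+k]+i]≡n : ∀ n k i → suc k ≤ n → i ≤ k → (k ∸ i) + suc ((n ∸ suc k) + i) ≡ n
[k∸i]+[1+[n∸1+k]+i]≡n n k i k<n i≤k =
  ≡.trans (ℕ.+-suc (k ∸ i) _)
  (≡.trans (≡.cong suc (≡.sym ([c+l]≡[l∸i]+[c+i] (n ∸ suc k) k i i≤k)))
  (≡.trans (≡.sym (ℕ.+-suc (n ∸ suc k) k)) (ℕ.m∸n+n≡m k<n)))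

module _ (k n : ℕ) (k<n : suc k ≤ n) where

  private
    G : ℕ → Poly
    G = diagonal (suc (n ∸ suc k))

    term : ℕ → Poly
    term i = fromℕₚ (n C suc (k ∸ i)) *ₚ (Eulerian (suc (k ∸ i)) *ₚ G i)

    recTerm : ℕ → Poly
    recTerm j = scaleₚ (+ (n C j)) (Eulerian j *ₚ E (suc k ∸ j) (n ∸ j))

  E-suc≋diagonal-form : E (suc (suc k)) (suc n) ≋ 1+x *ₚ G (suc k) +ₚ Xₚ *ₚ Σ (suc k) term
  E-suc≋diagonal-form = begin
    E (suc (suc k)) (suc n)
      ≈⟨ E≋diagonal (suc (suc k)) (suc n) ⟩
    G (suc (suc k))
      ≈⟨ diagonal-recurrence (suc (n ∸ suc k)) k ⟩
    1+x *ₚ G (suc k) +ₚ Xₚ *ₚ Σ (suc k) (λ i → G i *ₚ shiftedEulerian (suc (n ∸ suc k) + i) (k ∸ i))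
      ≈⟨ +-congˡ {1+x *ₚ G (suc k)}
           (*-congˡ {Xₚ} (Σ-cong-< (suc k) (λ i i≤k → binomialEulerian i (ℕ.≤-pred i≤k)))) ⟩
    1+x *ₚ G (suc k) +ₚ Xₚ *ₚ Σ (suc k) term ∎
    where
    binomialEulerian : ∀ i → i ≤ k → G i *ₚ shiftedEulerian (suc (n ∸ suc k) + i) (k ∸ i) ≋ term i
    binomialEulerian i i≤k = begin
      G i *ₚ shiftedEulerian (suc (n ∸ suc k) + i) (k ∸ i)
        ≈⟨ *-congˡ {G i} (shiftedEulerian-binomial ((n ∸ suc k) + i) (k ∸ i)) ⟩
      G i *ₚ (fromℕₚ (((k ∸ i) + suc ((n ∸ suc k) + i)) C suc (k ∸ i)) *ₚ shiftedEulerian 1 (k ∸ i))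
        ≡⟨ ≡.cong (λ m → G i *ₚ (fromℕₚ (m C suc (k ∸ i)) *ₚ shiftedEulerian 1 (k ∸ i)))
                  ([k∸i]+[1+[n∸1+k]+i]≡n n k i k<n i≤k) ⟩
      G i *ₚ (fromℕₚ (n C suc (k ∸ i)) *ₚ shiftedEulerian 1 (k ∸ i))
        ≈⟨ *-congˡ {G i} (*-congˡ {fromℕₚ (n C suc (k ∸ i))} (Eulerian≋shiftedEulerian (k ∸ i))) ⟨
      G i *ₚ (fromℕₚ (n C suc (k ∸ i)) *ₚ Eulerian (suc (k ∸ i)))
        ≈⟨ *-comm (G i) _ ⟩
      (fromℕₚ (n C suc (k ∸ i)) *ₚ Eulerian (suc (k ∸ i))) *ₚ G i
        ≈⟨ *-assoc (fromℕₚ (n C suc (k ∸ i))) (Eulerian (suc (k ∸ i))) (G i) ⟩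
      term i ∎

  recRHS≋diagonal-form : recRHS E (suc k) n ≋ 1+x *ₚ G (suc k) +ₚ Xₚ *ₚ Σ (suc k) term
  recRHS≋diagonal-form = begin
    E (suc k) n +ₚ Xₚ *ₚ sumMap recTerm (upTo (suc (suc k)))
      ≈⟨ +-cong (E≋diagonal (suc k) n) (*-congˡ {Xₚ} sumEq) ⟩
    G (suc k) +ₚ Xₚ *ₚ (G (suc k) +ₚ Σ (suc k) term)
      ≈⟨ +-congˡ {G (suc k)} (distribˡ Xₚ (G (suc k)) (Σ (suc k) term)) ⟩
    G (suc k) +ₚ (Xₚ *ₚ G (suc k) +ₚ Xₚ *ₚ Σ (suc k) term)
      ≈⟨ +-assoc (G (suc k)) (Xₚ *ₚ G (suc k)) (Xₚ *ₚ Σ (suc k) term) ⟨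
    (G (suc k) +ₚ Xₚ *ₚ G (suc k)) +ₚ Xₚ *ₚ Σ (suc k) term
      ≈⟨ +-congʳ (≋-trans (distribʳ (G (suc k)) 1ₚ Xₚ) (+-congʳ (*-identityˡ (G (suc k))))) ⟨
    1+x *ₚ G (suc k) +ₚ Xₚ *ₚ Σ (suc k) term ∎
    where
    E≋G : ∀ j → j ≤ suc k → E (suc k ∸ j) (n ∸ j) ≋ G (suc k ∸ j)
    E≋G j j≤1+k = ≋-trans (E≋diagonal (suc k ∸ j) (n ∸ j))
                          (≋-reflexive (≡.cong (λ d → diagonal (suc d) (suc k ∸ j)) ([n∸j]∸[k∸j]≡n∸k n j≤1+k)))

    first : recTerm 0 ≋ G (suc k)
    first = ≋-trans (recRHS-term-0 n (E (suc k) n)) (E≋diagonal (suc k) n)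

    later : ∀ i → i < suc k → recTerm (suc (k ∸ i)) ≋ term i
    later i i≤k =
      ≋-trans (scaleₚ≋fromℕₚ-*ₚ (n C suc (k ∸ i)) _)
              (*-congˡ {fromℕₚ (n C suc (k ∸ i))} (*-congˡ {Eulerian (suc (k ∸ i))}
                (≋-trans (E≋G (suc (k ∸ i)) (s≤s (ℕ.m∸n≤m k i)))
                         (≋-reflexive (≡.cong G (ℕ.m∸[m∸n]≡n (ℕ.≤-pred i≤k)))))))

    sumEq : sumMap recTerm (upTo (suc (suc k))) ≋ G (suc k) +ₚ Σ (suc k) term
    sumEq = begin
      sumMap recTerm (upTo (suc (suc k)))               ≈⟨ sumMap-upTo recTerm (suc (suc k)) ⟩
      Σ (suc (suc k)) recTerm                           ≈⟨ Σ-head (suc k) recTerm ⟩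
      recTerm 0 +ₚ Σ (suc k) (recTerm ∘ suc)            ≈⟨ +-cong first (Σ-reverse (suc k) (recTerm ∘ suc)) ⟩
      G (suc k) +ₚ Σ (suc k) (λ i → recTerm (suc (k ∸ i))) ≈⟨ +-congˡ {G (suc k)} (Σ-cong-< (suc k) later) ⟩
      G (suc k) +ₚ Σ (suc k) term                       ∎

E-recurrence : ∀ k n → k ≤ n → E (suc k) (suc n) ≋ recRHS E k n
E-recurrence zero    n _   =
  ≋-sym (+-congˡ {1ₚ} (≋-trans (*-congˡ {Xₚ} (≋-trans (+-identityʳ _) (recRHS-term-0 n 1ₚ))) (*-identityʳ Xₚ)))
E-recurrence (suc k) n k<n = ≋-trans (E-suc≋diagonal-form k n k<n) (≋-sym (recRHS≋diagonal-form k n k<n))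

scaleₚ-cong : ∀ c {p q} → p ≋ q → scaleₚ c p ≋ scaleₚ c q
scaleₚ-cong c p≋q = mk≋ (λ i → ≡.cong (c ℤ.*_) (pointwise p≋q i))

recRHS-cong : ∀ F F′ k n → (∀ j → j ≤ k → F (k ∸ j) (n ∸ j) ≋ F′ (k ∸ j) (n ∸ j)) →
              recRHS F k n ≋ recRHS F′ k n
recRHS-cong F F′ k n F≋F′ = +-cong (F≋F′ 0 z≤n) (*-congˡ {Xₚ} (begin
  sumMap (term F) (upTo (suc k))   ≈⟨ sumMap-upTo (term F) (suc k) ⟩
  Σ (suc k) (term F)               ≈⟨ Σ-cong-< (suc k) (λ j j≤k → scaleₚ-cong (+ (n C j))
                                        (*-congˡ {Eulerian j} (F≋F′ j (ℕ.≤-pred j≤k)))) ⟩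
  Σ (suc k) (term F′)              ≈⟨ sumMap-upTo (term F′) (suc k) ⟨
  sumMap (term F′) (upTo (suc k))  ∎))
  where
  term : (ℕ → ℕ → Poly) → ℕ → Poly
  term H j = scaleₚ (+ (n C j)) (Eulerian j *ₚ H (k ∸ j) (n ∸ j))

E-unique : ∀ (F : ℕ → ℕ → Poly) → (∀ n → F zero n ≈ₚ 1ₚ) →
           (∀ k n → k ≤ n → F (suc k) (suc n) ≈ₚ recRHS F k n) →
           ∀ k n → k ≤ n → F k n ≋ E k n
E-unique F F-0 F-rec k n k≤n = agree k k n ℕ.≤-refl k≤n
  where
  agree : ∀ b k n → k ≤ b → k ≤ n → F k n ≋ E k n
  agree b       zero    n       _         _         = mk≋ (F-0 n)
  agree (suc b) (suc k) (suc n) (s≤s k≤b) (s≤s k≤n) = begin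
    F (suc k) (suc n)  ≈⟨ mk≋ (F-rec k n k≤n) ⟩
    recRHS F k n       ≈⟨ recRHS-cong F E k n (λ j j≤k →
                            agree b (k ∸ j) (n ∸ j) (ℕ.≤-trans (ℕ.m∸n≤m k j) k≤b) (ℕ.∸-monoˡ-≤ j k≤n)) ⟩
    recRHS E k n       ≈⟨ E-recurrence k n k≤n ⟨
    E (suc k) (suc n)  ∎

lemmaB1 : ((k n : ℕ) → k ≤ n → E (suc k) (suc n) ≈ₚ recRHS E k n)
          × ((F : ℕ → ℕ → Poly)
             → ((n : ℕ) → F zero n ≈ₚ 1ₚ)
             → ((k n : ℕ) → k ≤ n → F (suc k) (suc n) ≈ₚ recRHS F k n)
             → (k n : ℕ) → k ≤ n → F k n ≈ₚ E k n)
lemmaB1 = (λ k n k≤n → pointwise (E-recurrence k n k≤n))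
        , (λ F F-0 F-rec k n k≤n → pointwise (E-unique F F-0 F-rec k n k≤n))
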